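{- Let $\mathcal N$, a flower type, and $\mathcal K\in\{\mathbb N^*,\{2\},\{1,2\},\{1\}\}$ be fixed, with flower generating function $F(z)$ and $F^*(z)=F(z)-1$. Let $\kappa$ be a parameter on the flowers of trees on one of the classes $\mathcal R,\mathcal S,\mathcal T$ (or $\mathcal R^*,\mathcal S^*,\mathcal T^*$), with associated bivariate flower generating function $F(z,u)$ (so $F(z,1)=F(z)$), and let $F_u(z)=\frac{\partial}{\partial u}F(z,u)|_{u=1}$ and $\Omega(z)=\frac{\partial}{\partial u}f(z,u)|_{u=1}$ the cumulative generating function. Square roots denote the branch equal to $1$ at $z=0$, and $F$ stands for $F(z)$. Then: 1. If $\mathcal K=\mathbb N^*$: for $\mathcal R$, $\Omega=\frac{(1+z-zF)F_u}{2\sqrt{z^2F^2-2(z+z^2)F+(1-z)^2}}+\frac{F_u}{2}$; for $\mathcal S$, $\Omega=\frac{(1-2zF)F_u}{2zF^2\sqrt{1-4zF}}-\frac{F_u}{2zF^2}$; for $\mathcal T$, $\Omega=\frac{F_u}{\sqrt{1-4zF}}$. 2. If $\mathcal K=\{2\}$: for $\mathcal R$, $\Omega=\frac{F_u}{\sqrt{1-4z^2F}}$; for $\mathcal S$, $\Omega=\frac{(1-2z^2F^2)F_u}{z^2F^3\sqrt{1-4z^2F^2}}-\frac{F_u}{z^2F^3}$; for $\mathcal T$, $\Omega=\frac{F_u}{2z^2F^2\sqrt{1-4z^2F^2}}-\frac{F_u}{2z^2F^2}$. 3. If $\mathcal K=\{1,2\}$: for $\mathcal R$, $\Omega=\frac{F_u}{\sqrt{(1-z)^2-4z^2F}}$;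 for $\mathcal S$, $\Omega=\frac{(2-3zF-3z^2F^2)F_u}{2z^2F^3\sqrt{1-2zF-3z^2F^2}}+\frac{(zF-2)F_u}{2z^2F^3}$; for $\mathcal T$, $\Omega=\frac{(1-zF)F_u}{2z^2F^2\sqrt{1-2zF-3z^2F^2}}-\frac{F_u}{2z^2F^2}$. 4. If $\mathcal K=\{1\}$: for $\mathcal R$, $\Omega=\frac{F_u}{1-z}$; for $\mathcal S$, $\Omega=\frac{zF_u}{(1-zF)^2}$; for $\mathcal T$, $\Omega=\frac{F_u}{(1-zF)^2}$. 5. For $\mathcal R^*,\mathcal S^*,\mathcal T^*$, $\Omega$ is given by the same formulas as for $\mathcal R,\mathcal S,\mathcal T$ respectively, with $F(z)$ replaced by $F^*(z)$ (and $F_u$ unchanged).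
   Context: A tree is a rooted plane tree; a $\mathcal K$-tree ($\mathcal K\subseteq\mathbb N^*$) is one whose internal nodes have numbers of children in $\mathcal K$; $K(w)=\sum_{k\in\mathcal K}w^k$. For nonempty $\mathcal N\subseteq\mathbb N^*$, a non-plane $\mathcal N$-flower is an integer partition with parts (petals) in $\mathcal N$ (generating function $\prod_{n\in\mathcal N}(1-z^n)^{ -1}$), a rooted-plane $\mathcal N$-flower is an integer composition with parts in $\mathcal N$ (generating function $(1-N(z))^{ -1}$, $N(z)=\sum_{n\in\mathcal N}z^n$); $F(z)$ denotes the generating function of the chosen flower class (size = sum of parts, $F(0)=1$). Size of a tree with flowers = tree edges + total flower sizes. Generating functions: $R=F+K(zR)$ (flowers on leaves), $S=1+K(zFS)$ (flowers on all nodes but the root), $T=FS$ (flowers everywhere); $R^*,S^*,T^*$ are the same with $F$ replaced by $F^*=F-1$ (no empty flowers). A parameter on the flowers of trees is a parameter $\kappa$ whose bivariate generating function $f(z,u)$ ($u$ marking $\kappa$) is obtained from the generating function $f(z)$ of the class by replacing $F(z)$ with a bivariate series $F(z,u)$ with $F(z,1)=F(z)$ (for $*$-classes, $F(z)^*$ is replaced by $F(z,u)-1$). Examples: number of petals $\chi$, with $F(z,u)=\prod_{n\in\mathcal N}(1-uz^n)^{ -1}$ or $(1-uN(z))^{ -1}$; number of edges in petals $\xi$, with $F(z,u)=F(uz)$. -}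

module Defs where

open import Data.Nat using (ℕ; zero; suc; _∸_; _≤_; _≤ᵇ_)
import Data.Nat as ℕ
open import Data.Integer using (+_)
open import Data.Rational using (ℚ; 0ℚ; 1ℚ; _+_; _*_; _-_; _/_)
open import Data.Bool using (Bool; true; false; if_then_else_; _∨_)
open import Data.Product using (Σ; _×_; proj₁)
open import Relation.Binary.PropositionalEquality using (_≡_)

ℕtoℚ : ℕ → ℚ
ℕtoℚ n = + n / 1

Σ< : ℕ → (ℕ → ℚ) → ℚ
Σ< zero    f = 0ℚ
Σ< (suc n) f = Σ< n f + f n

Σℕ< : ℕ → (ℕ → ℕ) → ℕ
Σℕ< zero    f = 0
Σℕ< (suc n) f = Σℕ< n f ℕ.+ f n

isZero : ℕ → Bool
isZero zero    = true
isZero (suc _) = false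

PS : Set
PS = ℕ → ℚ

_≈ₚ_ : PS → PS → Set
a ≈ₚ b = ∀ n → a n ≡ b n

infix 4 _≈ₚ_ _≈_
infixl 6 _⊕_ _⊖_ _⊞_ _⊟_
infixl 7 _⊗_ _⊠_

_⊕_ : PS → PS → PS
(a ⊕ b) n = a n + b n

_⊖_ : PS → PS → PS
(a ⊖ b) n = a n - b n

_⊗_ : PS → PS → PS
(a ⊗ b) n = Σ< (suc n) λ i → a i * b (n ∸ i)

cst : ℚ → PS
cst q zero    = q
cst q (suc _) = 0ℚ

nat : ℕ → PS
nat m = cst (ℕtoℚ m)

zₚ : PS
zₚ zero          = 0ℚ
zₚ (suc zero)    = 1ℚ
zₚ (suc (suc _)) = 0ℚ

-- Bivariate formal power series over ℚ: B n k = coefficient of z^n u^k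

BS : Set
BS = ℕ → ℕ → ℚ

_≈_ : BS → BS → Set
A ≈ B = ∀ n k → A n k ≡ B n k

_⊞_ : BS → BS → BS
(A ⊞ B) n k = A n k + B n k

_⊟_ : BS → BS → BS
(A ⊟ B) n k = A n k - B n k

_⊠_ : BS → BS → BS
(A ⊠ B) n k = Σ< (suc n) λ i → Σ< (suc k) λ j → A i j * B (n ∸ i) (k ∸ j)

oneB : BS
oneB zero    zero    = 1ℚ
oneB zero    (suc _) = 0ℚ
oneB (suc _) _       = 0ℚ

zB : BS → BS
zB A zero    k = 0ℚ
zB A (suc n) k = A n k

-- For each power of z the coefficient is a polynomial in u
-- (finitely many nonzero u-coefficients); this is what makes
-- evaluation / differentiation at u = 1 meaningful for formal series.
UFin : BS → Set
UFin B = (n : ℕ) → Σ ℕ λ d → (k : ℕ) → d ≤ k → B n k ≡ 0ℚ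

at1 : (B : BS) → UFin B → PS
at1 B fin n = Σ< (proj₁ (fin n)) λ k → B n k

du1 : (B : BS) → UFin B → PS
du1 B fin n = Σ< (proj₁ (fin n)) λ k → ℕtoℚ k * B n k

-- Flowers.  𝒩 ⊆ ℕ* is given by a boolean predicate N.

data FlowerKind : Set where
  nonPlane rootedPlane : FlowerKind

-- number of integer partitions of n with parts in 𝒩 ∩ {1..m}
-- (recursion on m: choose the number j of parts equal to m+1)
partCount : (ℕ → Bool) → ℕ → ℕ → ℕ
partCount N n zero    = if isZero n then 1 else 0
partCount N n (suc m) =
  Σℕ< (suc n) λ j →
    if (j ℕ.* suc m ≤ᵇ n) ∧' (isZero j ∨ N (suc m))
    then partCount N (n ∸ j ℕ.* suc m) m else 0
  where
  _∧'_ : Bool → Bool → Bool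
  true  ∧' b = b
  false ∧' _ = false

-- number of compositions of n into exactly p parts, parts in 𝒩
compCountP : (ℕ → Bool) → ℕ → ℕ → ℕ
compCountP N n zero    = if isZero n then 1 else 0
compCountP N n (suc p) =
  Σℕ< n λ i → if N (suc i) then compCountP N (n ∸ suc i) p else 0

-- number of compositions of n with parts in 𝒩 (at most n parts since 𝒩 ⊆ ℕ*)
compCount : (ℕ → Bool) → ℕ → ℕ
compCount N n = Σℕ< (suc n) λ p → compCountP N n p

flowerGF : FlowerKind → (ℕ → Bool) → PS
flowerGF nonPlane    N n = ℕtoℚ (partCount N n n)
flowerGF rootedPlane N n = ℕtoℚ (compCount N n)

data KType : Set where
  Kall K2 K12 K1 : KType    -- 𝒦 = ℕ*, {2}, {1,2}, {1}

data Cls : Set where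
  clsR clsS clsT : Cls

-- IsK 𝒦 w v  means  v = K(w) = Σ_{k∈𝒦} w^k   (w will always be
-- divisible by z, so this determines v uniquely; for 𝒦 = ℕ* the
-- geometric series Σ_{k≥1} w^k is characterised by v = w + w v).
IsK : KType → BS → BS → Set
IsK Kall w v = v ≈ w ⊞ w ⊠ v
IsK K2   w v = v ≈ w ⊠ w
IsK K12  w v = v ≈ w ⊞ w ⊠ w
IsK K1   w v = v ≈ w

-- flower series used: F(z,u) (plain classes) or F(z,u) - 1 (starred)
Φ : Bool → BS → BS
Φ false Fb = Fb
Φ true  Fb = Fb ⊟ oneB

Gof : Bool → PS → PS
Gof false F = F
Gof true  F = F ⊖ nat 1

-- f is the bivariate generating function of class cls with flower series P:
--   R = P + K(zR),   S = 1 + K(zPS),   T = P S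
IsClassGF : KType → Cls → BS → BS → Set
IsClassGF K clsR P f = Σ BS λ v → IsK K (zB f) v × f ≈ P ⊞ v
IsClassGF K clsS P f = Σ BS λ v → IsK K (zB (P ⊠ f)) v × f ≈ oneB ⊞ v
IsClassGF K clsT P f = Σ BS λ s → Σ BS λ v →
  IsK K (zB (P ⊠ s)) v × s ≈ oneB ⊞ v × f ≈ P ⊠ s

-- The closed forms (denominators cleared; √Δ is any series s with
-- s(0) = 1 and s² = Δ).

IsSqrt : PS → PS → Set
IsSqrt s Δ = (s 0 ≡ 1ℚ) × (s ⊗ s ≈ₚ Δ)

Formula : KType → Cls → PS → PS → PS → Set
Formula Kall clsR G Fu Ω = ∀ s →
  IsSqrt s (zₚ ⊗ zₚ ⊗ G ⊗ G ⊖ nat 2 ⊗ (zₚ ⊕ zₚ ⊗ zₚ) ⊗ G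
            ⊕ (nat 1 ⊖ zₚ) ⊗ (nat 1 ⊖ zₚ)) →
  nat 2 ⊗ s ⊗ Ω ≈ₚ (nat 1 ⊕ zₚ ⊖ zₚ ⊗ G) ⊗ Fu ⊕ s ⊗ Fu
Formula Kall clsS G Fu Ω = ∀ s →
  IsSqrt s (nat 1 ⊖ nat 4 ⊗ zₚ ⊗ G) →
  nat 2 ⊗ zₚ ⊗ G ⊗ G ⊗ s ⊗ Ω ≈ₚ (nat 1 ⊖ nat 2 ⊗ zₚ ⊗ G) ⊗ Fu ⊖ s ⊗ Fu
Formula Kall clsT G Fu Ω = ∀ s →
  IsSqrt s (nat 1 ⊖ nat 4 ⊗ zₚ ⊗ G) →
  s ⊗ Ω ≈ₚ Fu
Formula K2 clsR G Fu Ω = ∀ s →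
  IsSqrt s (nat 1 ⊖ nat 4 ⊗ zₚ ⊗ zₚ ⊗ G) →
  s ⊗ Ω ≈ₚ Fu
Formula K2 clsS G Fu Ω = ∀ s →
  IsSqrt s (nat 1 ⊖ nat 4 ⊗ zₚ ⊗ zₚ ⊗ G ⊗ G) →
  zₚ ⊗ zₚ ⊗ G ⊗ G ⊗ G ⊗ s ⊗ Ω
    ≈ₚ (nat 1 ⊖ nat 2 ⊗ zₚ ⊗ zₚ ⊗ G ⊗ G) ⊗ Fu ⊖ s ⊗ Fu
Formula K2 clsT G Fu Ω = ∀ s →
  IsSqrt s (nat 1 ⊖ nat 4 ⊗ zₚ ⊗ zₚ ⊗ G ⊗ G) →
  nat 2 ⊗ zₚ ⊗ zₚ ⊗ G ⊗ G ⊗ s ⊗ Ω ≈ₚ Fu ⊖ s ⊗ Fu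
Formula K12 clsR G Fu Ω = ∀ s →
  IsSqrt s ((nat 1 ⊖ zₚ) ⊗ (nat 1 ⊖ zₚ) ⊖ nat 4 ⊗ zₚ ⊗ zₚ ⊗ G) →
  s ⊗ Ω ≈ₚ Fu
Formula K12 clsS G Fu Ω = ∀ s →
  IsSqrt s (nat 1 ⊖ nat 2 ⊗ zₚ ⊗ G ⊖ nat 3 ⊗ zₚ ⊗ zₚ ⊗ G ⊗ G) →
  nat 2 ⊗ zₚ ⊗ zₚ ⊗ G ⊗ G ⊗ G ⊗ s ⊗ Ω
    ≈ₚ (nat 2 ⊖ nat 3 ⊗ zₚ ⊗ G ⊖ nat 3 ⊗ zₚ ⊗ zₚ ⊗ G ⊗ G) ⊗ Fu
       ⊕ (zₚ ⊗ G ⊖ nat 2) ⊗ Fu ⊗ s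
Formula K12 clsT G Fu Ω = ∀ s →
  IsSqrt s (nat 1 ⊖ nat 2 ⊗ zₚ ⊗ G ⊖ nat 3 ⊗ zₚ ⊗ zₚ ⊗ G ⊗ G) →
  nat 2 ⊗ zₚ ⊗ zₚ ⊗ G ⊗ G ⊗ s ⊗ Ω ≈ₚ (nat 1 ⊖ zₚ ⊗ G) ⊗ Fu ⊖ s ⊗ Fu
Formula K1 clsR G Fu Ω = (nat 1 ⊖ zₚ) ⊗ Ω ≈ₚ Fu
Formula K1 clsS G Fu Ω = (nat 1 ⊖ zₚ ⊗ G) ⊗ (nat 1 ⊖ zₚ ⊗ G) ⊗ Ω ≈ₚ zₚ ⊗ Fu
Formula K1 clsT G Fu Ω = (nat 1 ⊖ zₚ ⊗ G) ⊗ (nat 1 ⊖ zₚ ⊗ G) ⊗ Ω ≈ₚ Fu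

{-# OPTIONS --safe #-}
-- Evaluation at u = 1 is a ring homomorphism and the u-derivative at u = 1 a derivation (both
-- computed on the finitely many u-coefficients of each power of z), so the functional equation
-- of each class gives, at u = 1, a polynomial equation for y = f(z,1) and, by implicit
-- differentiation, a linear equation σ Ω = N F_u, where σ is the derivative of the polynomial
-- equation in y. When that equation is quadratic, σ = 1 − z(…) squares to its discriminant Δ,
-- and since a series with constant term 1 has only one square root with constant term 1,
-- σ = √Δ; then σ Ω = N F_u is the closed form. Every step is a ring identity modulo the
-- equations at hand, given below as an explicit linear combination that the ring solver checks.
module Submission where

open import Defs
open import Data.Bool using (Bool; true; false)
open import Data.Nat using (ℕ; zero; suc; _∸_; _≤_; _<_; z≤n; s≤s)
import Data.Nat as ℕ
import Data.Nat.Properties as ℕₚ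
open import Data.Nat.Induction using (<-rec)
import Data.Nat.Coprimality as Coprimality
import Data.Integer as ℤ
import Data.Integer.Properties as ℤₚ
open import Data.Rational using (ℚ; mkℚ; 0ℚ; 1ℚ; ½; _+_; _*_; -_; _/_; _≟_)
import Data.Rational as ℚ
open import Data.Rational.Properties
open import Data.Maybe using (Maybe; just; nothing)
open import Data.Product using (Σ; ∃; _×_; _,_; proj₁; proj₂)
open import Data.Sum using (inj₁; inj₂)
open import Relation.Nullary using (yes; no)
open import Relation.Binary.PropositionalEquality
open import Algebra.Bundles using (CommutativeMonoid; CommutativeRing)
import Algebra.Solver.Ring.AlmostCommutativeRing as ACR
open import Algebra.Properties.CommutativeSemigroup
  (CommutativeMonoid.commutativeSemigroup +-0-commutativeMonoid) using (interchange)
open import Algebra.Properties.CommutativeSemigroup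
  (CommutativeMonoid.commutativeSemigroup *-1-commutativeMonoid) using (x∙yz≈y∙xz)

open ≡-Reasoning

Σ<-cong : ∀ n {f g : ℕ → ℚ} → (∀ i → i < n → f i ≡ g i) → Σ< n f ≡ Σ< n g
Σ<-cong zero    f≡g = refl
Σ<-cong (suc n) f≡g =
  cong₂ _+_ (Σ<-cong n λ i i<n → f≡g i (ℕₚ.m<n⇒m<1+n i<n)) (f≡g n ℕₚ.≤-refl)

Σ<-zero : ∀ n {f : ℕ → ℚ} → (∀ i → i < n → f i ≡ 0ℚ) → Σ< n f ≡ 0ℚ
Σ<-zero zero    f≡0 = refl
Σ<-zero (suc n) f≡0 = begin
  Σ< n _ + _  ≡⟨ cong₂ _+_ (Σ<-zero n λ i i<n → f≡0 i (ℕₚ.m<n⇒m<1+n i<n)) (f≡0 n ℕₚ.≤-refl) ⟩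
  0ℚ + 0ℚ     ≡⟨ +-identityˡ 0ℚ ⟩
  0ℚ          ∎

Σ<-+ : ∀ n (f g : ℕ → ℚ) → Σ< n (λ i → f i + g i) ≡ Σ< n f + Σ< n g
Σ<-+ zero    f g = sym (+-identityˡ 0ℚ)
Σ<-+ (suc n) f g =
  trans (cong (_+ (f n + g n)) (Σ<-+ n f g)) (interchange (Σ< n f) (Σ< n g) (f n) (g n))

Σ<-neg : ∀ n (f : ℕ → ℚ) → Σ< n (λ i → - f i) ≡ - Σ< n f
Σ<-neg zero    f = refl
Σ<-neg (suc n) f = trans (cong (_+ - f n) (Σ<-neg n f)) (sym (neg-distrib-+ (Σ< n f) (f n)))

Σ<-*ˡ : ∀ n c (f : ℕ → ℚ) → Σ< n (λ i → c * f i) ≡ c * Σ< n f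
Σ<-*ˡ zero    c f = sym (*-zeroʳ c)
Σ<-*ˡ (suc n) c f = trans (cong (_+ c * f n) (Σ<-*ˡ n c f)) (sym (*-distribˡ-+ c _ _))

Σ<-*ʳ : ∀ n c (f : ℕ → ℚ) → Σ< n (λ i → f i * c) ≡ Σ< n f * c
Σ<-*ʳ n c f = begin
  Σ< n (λ i → f i * c) ≡⟨ Σ<-cong n (λ i _ → *-comm (f i) c) ⟩
  Σ< n (λ i → c * f i) ≡⟨ Σ<-*ˡ n c f ⟩
  c * Σ< n f           ≡⟨ *-comm c _ ⟩
  Σ< n f * c           ∎

Σ<-swap : ∀ n m (f : ℕ → ℕ → ℚ) →
  Σ< n (λ i → Σ< m (f i)) ≡ Σ< m (λ j → Σ< n (λ i → f i j))
Σ<-swap zero    m f = sym (Σ<-zero m λ _ _ → refl)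
Σ<-swap (suc n) m f = begin
  Σ< n (λ i → Σ< m (f i)) + Σ< m (f n)          ≡⟨ cong (_+ Σ< m (f n)) (Σ<-swap n m f) ⟩
  Σ< m (λ j → Σ< n (λ i → f i j)) + Σ< m (f n)  ≡⟨ Σ<-+ m _ _ ⟨
  Σ< m (λ j → Σ< n (λ i → f i j) + f n j)       ∎

Σ<-shift : ∀ n (f : ℕ → ℚ) → Σ< (suc n) f ≡ f 0 + Σ< n (λ i → f (suc i))
Σ<-shift zero    f = trans (+-identityˡ (f 0)) (sym (+-identityʳ (f 0)))
Σ<-shift (suc n) f = trans (cong (_+ f (suc n)) (Σ<-shift n f)) (+-assoc (f 0) _ _)

Σ<-reverse : ∀ n (f : ℕ → ℚ) → Σ< (suc n) f ≡ Σ< (suc n) (λ i → f (n ∸ i))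
Σ<-reverse zero    f = refl
Σ<-reverse (suc n) f = begin
  Σ< (suc n) f + f (suc n)                  ≡⟨ cong (_+ f (suc n)) (Σ<-reverse n f) ⟩
  Σ< (suc n) (λ i → f (n ∸ i)) + f (suc n)  ≡⟨ +-comm _ (f (suc n)) ⟩
  f (suc n) + Σ< (suc n) (λ i → f (n ∸ i))  ≡⟨ Σ<-shift (suc n) (λ i → f (suc n ∸ i)) ⟨
  Σ< (suc (suc n)) (λ i → f (suc n ∸ i))    ∎

-- Summing g j l over the triangle j + l < n by rows of constant j + l, or by columns of constant j.
Σ<-triangle : ∀ n (g : ℕ → ℕ → ℚ) →
  Σ< n (λ k → Σ< (suc k) (λ j → g j (k ∸ j))) ≡ Σ< n (λ j → Σ< (n ∸ j) (g j))
Σ<-triangle zero    g = refl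
Σ<-triangle (suc n) g = begin
  rows + (Σ< n diagonal + g n (n ∸ n))
    ≡⟨ +-assoc rows (Σ< n diagonal) _ ⟨
  rows + Σ< n diagonal + g n (n ∸ n)
    ≡⟨ cong₂ (λ a b → a + Σ< n diagonal + g n b) (Σ<-triangle n g) (ℕₚ.n∸n≡0 n) ⟩
  Σ< n (λ j → Σ< (n ∸ j) (g j)) + Σ< n diagonal + g n 0
    ≡⟨ cong₂ _+_ (Σ<-+ n _ diagonal) (+-identityˡ (g n 0)) ⟨
  Σ< n (λ j → Σ< (n ∸ j) (g j) + g j (n ∸ j)) + (0ℚ + g n 0)
    ≡⟨ cong₂ _+_ (Σ<-cong n λ j j<n → cong (λ m → Σ< m (g j)) (sym (suc-∸ (ℕₚ.<⇒≤ j<n))))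
                 (cong (λ m → Σ< m (g n)) (sym (trans (suc-∸ (ℕₚ.≤-refl {n})) (cong suc (ℕₚ.n∸n≡0 n))))) ⟩
  Σ< n (λ j → Σ< (suc n ∸ j) (g j)) + Σ< (suc n ∸ n) (g n)
    ∎
  where
  rows : ℚ
  rows = Σ< n (λ k → Σ< (suc k) (λ j → g j (k ∸ j)))
  diagonal : ℕ → ℚ
  diagonal j = g j (n ∸ j)
  suc-∸ : ∀ {m j} → j ≤ m → suc m ∸ j ≡ suc (m ∸ j)
  suc-∸ = ℕₚ.+-∸-assoc 1

0P 1P : PS
0P = cst 0ℚ
1P = cst 1ℚ

negₚ : PS → PS
negₚ a n = - a n

cst-0 : ∀ n → cst 0ℚ n ≡ 0ℚ
cst-0 zero    = refl
cst-0 (suc n) = refl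

≈ₚ-refl : ∀ {a} → a ≈ₚ a
≈ₚ-refl n = refl

≈ₚ-sym : ∀ {a b} → a ≈ₚ b → b ≈ₚ a
≈ₚ-sym a≈b n = sym (a≈b n)

≈ₚ-trans : ∀ {a b c} → a ≈ₚ b → b ≈ₚ c → a ≈ₚ c
≈ₚ-trans a≈b b≈c n = trans (a≈b n) (b≈c n)

⊕-cong : ∀ {a a′ b b′} → a ≈ₚ a′ → b ≈ₚ b′ → a ⊕ b ≈ₚ a′ ⊕ b′
⊕-cong a≈ b≈ n = cong₂ _+_ (a≈ n) (b≈ n)

⊖-cong : ∀ {a a′ b b′} → a ≈ₚ a′ → b ≈ₚ b′ → a ⊖ b ≈ₚ a′ ⊖ b′
⊖-cong a≈ b≈ n = cong₂ ℚ._-_ (a≈ n) (b≈ n)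

⊗-cong : ∀ {a a′ b b′} → a ≈ₚ a′ → b ≈ₚ b′ → a ⊗ b ≈ₚ a′ ⊗ b′
⊗-cong a≈ b≈ n = Σ<-cong (suc n) λ i _ → cong₂ _*_ (a≈ i) (b≈ (n ∸ i))

⊗-comm : ∀ a b → a ⊗ b ≈ₚ b ⊗ a
⊗-comm a b n = begin
  Σ< (suc n) (λ i → a i * b (n ∸ i))              ≡⟨ Σ<-reverse n _ ⟩
  Σ< (suc n) (λ i → a (n ∸ i) * b (n ∸ (n ∸ i)))  ≡⟨ Σ<-cong (suc n) swap ⟩
  Σ< (suc n) (λ i → b i * a (n ∸ i))              ∎
  where
  swap : ∀ i → i < suc n → a (n ∸ i) * b (n ∸ (n ∸ i)) ≡ b i * a (n ∸ i)
  swap i i<1+n = trans (cong (λ j → a (n ∸ i) * b j) (ℕₚ.m∸[m∸n]≡n (ℕₚ.≤-pred i<1+n)))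
                       (*-comm (a (n ∸ i)) (b i))

⊗-assoc : ∀ a b c → (a ⊗ b) ⊗ c ≈ₚ a ⊗ (b ⊗ c)
⊗-assoc a b c n = begin
  Σ< (suc n) (λ k → Σ< (suc k) (λ j → a j * b (k ∸ j)) * c (n ∸ k))
    ≡⟨ Σ<-cong (suc n) (λ k _ → sym (Σ<-*ʳ (suc k) (c (n ∸ k)) _)) ⟩
  Σ< (suc n) (λ k → Σ< (suc k) (λ j → a j * b (k ∸ j) * c (n ∸ k)))
    ≡⟨ Σ<-cong (suc n) (λ k _ → Σ<-cong (suc k) λ j j<1+k →
         cong (λ m → a j * b (k ∸ j) * c (n ∸ m)) (sym (ℕₚ.m+[n∸m]≡n (ℕₚ.≤-pred j<1+k)))) ⟩
  Σ< (suc n) (λ k → Σ< (suc k) (λ j → g j (k ∸ j)))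
    ≡⟨ Σ<-triangle (suc n) g ⟩
  Σ< (suc n) (λ j → Σ< (suc n ∸ j) (g j))
    ≡⟨ Σ<-cong (suc n) (λ j j<1+n → trans (cong (λ m → Σ< m (g j)) (ℕₚ.+-∸-assoc 1 (ℕₚ.≤-pred j<1+n)))
         (Σ<-cong (suc (n ∸ j)) λ l _ → trans (*-assoc (a j) (b l) _)
            (cong (λ m → a j * (b l * c m)) (sym (ℕₚ.∸-+-assoc n j l))))) ⟩
  Σ< (suc n) (λ j → Σ< (suc (n ∸ j)) (λ l → a j * (b l * c (n ∸ j ∸ l))))
    ≡⟨ Σ<-cong (suc n) (λ j _ → Σ<-*ˡ (suc (n ∸ j)) (a j) _) ⟩
  Σ< (suc n) (λ j → a j * Σ< (suc (n ∸ j)) (λ l → b l * c (n ∸ j ∸ l)))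
    ∎
  where
  g : ℕ → ℕ → ℚ
  g j l = a j * b l * c (n ∸ (j ℕ.+ l))

⊗-distribˡ : ∀ a b c → a ⊗ (b ⊕ c) ≈ₚ a ⊗ b ⊕ a ⊗ c
⊗-distribˡ a b c n =
  trans (Σ<-cong (suc n) λ i _ → *-distribˡ-+ (a i) _ _) (Σ<-+ (suc n) _ _)

⊗-distribʳ : ∀ a b c → (b ⊕ c) ⊗ a ≈ₚ b ⊗ a ⊕ c ⊗ a
⊗-distribʳ a b c = ≈ₚ-trans (⊗-comm (b ⊕ c) a)
  (≈ₚ-trans (⊗-distribˡ a b c) (⊕-cong (⊗-comm a b) (⊗-comm a c)))

⊗-identityʳ : ∀ a → a ⊗ 1P ≈ₚ a
⊗-identityʳ a n = begin
  Σ< n (λ i → a i * cst 1ℚ (n ∸ i)) + a n * cst 1ℚ (n ∸ n)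
    ≡⟨ cong₂ _+_ (Σ<-zero n λ i i<n → cst-1-suc i (ℕₚ.m<n⇒0<n∸m i<n))
                 (cong (λ m → a n * cst 1ℚ m) (ℕₚ.n∸n≡0 n)) ⟩
  0ℚ + a n * 1ℚ  ≡⟨ trans (+-identityˡ _) (*-identityʳ (a n)) ⟩
  a n            ∎
  where
  cst-1-suc : ∀ i {m} → 0 < m → a i * cst 1ℚ m ≡ 0ℚ
  cst-1-suc i (s≤s _) = *-zeroʳ (a i)

⊗-identityˡ : ∀ a → 1P ⊗ a ≈ₚ a
⊗-identityˡ a = ≈ₚ-trans (⊗-comm 1P a) (⊗-identityʳ a)

zₚ⊗-zero : ∀ a → (zₚ ⊗ a) 0 ≡ 0ℚ
zₚ⊗-zero a = trans (+-identityˡ _) (*-zeroˡ (a 0))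

zₚ⊗-suc : ∀ a n → (zₚ ⊗ a) (suc n) ≡ a n
zₚ⊗-suc a n = begin
  Σ< (suc (suc n)) (λ i → zₚ i * a (suc n ∸ i))
    ≡⟨ Σ<-shift (suc n) _ ⟩
  0ℚ * a (suc n) + Σ< (suc n) (λ i → zₚ (suc i) * a (n ∸ i))
    ≡⟨ cong₂ _+_ (*-zeroˡ (a (suc n))) (Σ<-shift n _) ⟩
  0ℚ + (1ℚ * a n + Σ< n (λ i → 0ℚ * a (n ∸ suc i)))
    ≡⟨ +-identityˡ _ ⟩
  1ℚ * a n + Σ< n (λ i → 0ℚ * a (n ∸ suc i))
    ≡⟨ cong₂ _+_ (*-identityˡ (a n)) (Σ<-zero n λ i _ → *-zeroˡ (a (n ∸ suc i))) ⟩
  a n + 0ℚ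
    ≡⟨ +-identityʳ (a n) ⟩
  a n ∎

PS-commutativeRing : CommutativeRing _ _
PS-commutativeRing = record
  { Carrier = PS ; _≈_ = _≈ₚ_ ; _+_ = _⊕_ ; _*_ = _⊗_ ; -_ = negₚ ; 0# = 0P ; 1# = 1P
  ; isCommutativeRing = record
    { isRing = record
      { +-isAbelianGroup = record
        { isGroup = record
          { isMonoid = record
            { isSemigroup = record
              { isMagma = record
                { isEquivalence = record { refl = λ {a} → ≈ₚ-refl {a} ; sym = ≈ₚ-sym ; trans = ≈ₚ-trans }
                ; ∙-cong = ⊕-cong }
              ; assoc = λ a b c n → +-assoc (a n) (b n) (c n) }
            ; identity = (λ a n → trans (cong (_+ a n) (cst-0 n)) (+-identityˡ (a n)))
                       , (λ a n → trans (cong (a n +_) (cst-0 n)) (+-identityʳ (a n))) }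
          ; inverse = (λ a n → trans (+-inverseˡ (a n)) (sym (cst-0 n)))
                    , (λ a n → trans (+-inverseʳ (a n)) (sym (cst-0 n)))
          ; ⁻¹-cong = λ a≈ n → cong -_ (a≈ n) }
        ; comm = λ a b n → +-comm (a n) (b n) }
      ; *-cong = ⊗-cong
      ; *-assoc = ⊗-assoc
      ; *-identity = ⊗-identityˡ , ⊗-identityʳ
      ; distrib = ⊗-distribˡ , ⊗-distribʳ }
    ; *-comm = ⊗-comm } }

cst-morphism : ℚ.+-*-rawRing ACR.-Raw-AlmostCommutative⟶ ACR.fromCommutativeRing PS-commutativeRing
cst-morphism = record
  { ⟦_⟧    = cst
  ; +-homo = λ p q → λ { zero → refl ; (suc n) → sym (+-identityˡ 0ℚ) }
  ; *-homo = λ p q → λ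
      { zero    → sym (+-identityˡ (p * q))
      ; (suc n) → sym (Σ<-zero (suc (suc n)) λ { zero _ → *-zeroʳ p ; (suc i) _ → *-zeroˡ (cst q (n ∸ i)) }) }
  ; -‿homo = λ p → λ { zero → refl ; (suc n) → refl }
  ; 0-homo = λ n → refl
  ; 1-homo = λ n → refl }

cst-≟ : ∀ p q → Maybe (cst p ≈ₚ cst q)
cst-≟ p q with p ≟ q
... | yes refl = just ≈ₚ-refl
... | no _     = nothing

open import Algebra.Solver.Ring ℚ.+-*-rawRing (ACR.fromCommutativeRing PS-commutativeRing) cst-morphism cst-≟

open import Algebra.Properties.Ring (CommutativeRing.ring PS-commutativeRing)
  using (x∙y⁻¹≈ε⇒x≈y; x≈y⇒x∙y⁻¹≈ε)

infixl 5 _⊕₀_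
infix  6 _·_

-- X ≈ Y modulo hypotheses Lᵢ ≈ Rᵢ: the ring solver checks X − Y = Σ cᵢ (Lᵢ − Rᵢ), and each
-- cᵢ · (Lᵢ ≈ Rᵢ) makes one summand vanish.
by-combination : ∀ {X Y} E → X ⊖ Y ≈ₚ E → E ≈ₚ 0P → X ≈ₚ Y
by-combination {X} {Y} E X-Y≈E E≈0 = x∙y⁻¹≈ε⇒x≈y X Y (≈ₚ-trans X-Y≈E E≈0)

_·_ : ∀ c {L R} → L ≈ₚ R → c ⊗ (L ⊖ R) ≈ₚ 0P
c · L≈R = ≈ₚ-trans (⊗-cong {c} ≈ₚ-refl (x≈y⇒x∙y⁻¹≈ε L≈R)) (CommutativeRing.zeroʳ PS-commutativeRing c)

_⊕₀_ : ∀ {A B} → A ≈ₚ 0P → B ≈ₚ 0P → A ⊕ B ≈ₚ 0P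
A≈0 ⊕₀ B≈0 = ≈ₚ-trans (⊕-cong A≈0 B≈0) (CommutativeRing.+-identityʳ PS-commutativeRing 0P)

ν : ∀ {m} → ℕ → Polynomial m
ν k = con (ℕtoℚ k)

a⊗b≈0⇒a≈0 : ∀ {a b : PS} c → b 0 * c ≡ 1ℚ → a ⊗ b ≈ₚ 0P → a ≈ₚ 0P
a⊗b≈0⇒a≈0 {a} {b} c b₀c≡1 ab≈0 j = trans (<-rec (λ j → a j ≡ 0ℚ) step j) (sym (cst-0 j))
  where
  step : ∀ j → (∀ {i} → i < j → a i ≡ 0ℚ) → a j ≡ 0ℚ
  step j ih = begin
    a j                  ≡⟨ *-identityʳ (a j) ⟨
    a j * 1ℚ             ≡⟨ cong (a j *_) b₀c≡1 ⟨
    a j * (b 0 * c)      ≡⟨ *-assoc (a j) (b 0) c ⟨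
    a j * b 0 * c        ≡⟨ cong (λ i → a j * b i * c) (ℕₚ.n∸n≡0 j) ⟨
    a j * b (j ∸ j) * c  ≡⟨ cong (_* c) leading ⟩
    0ℚ * c               ≡⟨ *-zeroˡ c ⟩
    0ℚ                   ∎
    where
    leading : a j * b (j ∸ j) ≡ 0ℚ
    leading = begin
      a j * b (j ∸ j)                                  ≡⟨ +-identityˡ _ ⟨
      0ℚ + a j * b (j ∸ j)                             ≡⟨ cong (_+ a j * b (j ∸ j)) (Σ<-zero j earlier) ⟨
      Σ< j (λ i → a i * b (j ∸ i)) + a j * b (j ∸ j)   ≡⟨ ab≈0 j ⟩
      cst 0ℚ j                                         ≡⟨ cst-0 j ⟩
      0ℚ                                               ∎
      where
      earlier : ∀ i → i < j → a i * b (j ∸ i) ≡ 0ℚ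
      earlier i i<j = trans (cong (_* b (j ∸ i)) (ih i<j)) (*-zeroˡ (b (j ∸ i)))

-- (σ − s)(σ + s) = Δ − Δ, and σ + s has the invertible constant term 2.
IsSqrt-unique : ∀ {σ s Δ} → IsSqrt σ Δ → IsSqrt s Δ → σ ≈ₚ s
IsSqrt-unique {σ} {s} {Δ} (σ₀ , σ²≈Δ) (s₀ , s²≈Δ) = x∙y⁻¹≈ε⇒x≈y σ s
  (a⊗b≈0⇒a≈0 {σ ⊖ s} {σ ⊕ s} ½ (cong (_* ½) (cong₂ _+_ σ₀ s₀)) (by-combination _
    (solve 2 (λ σ s → (σ :- s) :* (σ :+ s) :- ν 0 := σ :* σ :- s :* s) (λ _ → refl) σ s)
    (≈ₚ-trans (⊖-cong σ²≈Δ s²≈Δ) (x≈y⇒x∙y⁻¹≈ε {Δ} ≈ₚ-refl))))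

1-z⊗-constant : ∀ x → (nat 1 ⊖ zₚ ⊗ x) 0 ≡ 1ℚ
1-z⊗-constant x = cong (λ c → 1ℚ ℚ.- c) (zₚ⊗-zero x)

IsSqrt-unique-1-z⊗ : ∀ x {Δ s} → (nat 1 ⊖ zₚ ⊗ x) ⊗ (nat 1 ⊖ zₚ ⊗ x) ≈ₚ Δ → IsSqrt s Δ → nat 1 ⊖ zₚ ⊗ x ≈ₚ s
IsSqrt-unique-1-z⊗ x σ²≈Δ = IsSqrt-unique (1-z⊗-constant x , σ²≈Δ)

VanishesFrom : (ℕ → ℚ) → ℕ → Set
VanishesFrom a d = ∀ k → d ≤ k → a k ≡ 0ℚ

VanishesFrom-mono : ∀ {a d e} → d ≤ e → VanishesFrom a d → VanishesFrom a e
VanishesFrom-mono d≤e a≡0 k e≤k = a≡0 k (ℕₚ.≤-trans d≤e e≤k)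

Σ<-extend : ∀ {a d e} → VanishesFrom a d → d ≤ e → Σ< e a ≡ Σ< d a
Σ<-extend {a} {d} {e} a≡0 d≤e = begin
  Σ< e a              ≡⟨ cong (λ m → Σ< m a) (ℕₚ.m+[n∸m]≡n d≤e) ⟨
  Σ< (d ℕ.+ (e ∸ d)) a ≡⟨ padding (e ∸ d) ⟩
  Σ< d a              ∎
  where
  padding : ∀ m → Σ< (d ℕ.+ m) a ≡ Σ< d a
  padding zero    = cong (λ m → Σ< m a) (ℕₚ.+-identityʳ d)
  padding (suc m) = begin
    Σ< (d ℕ.+ suc m) a             ≡⟨ cong (λ m → Σ< m a) (ℕₚ.+-suc d m) ⟩
    Σ< (d ℕ.+ m) a + a (d ℕ.+ m)   ≡⟨ cong₂ _+_ (padding m) (a≡0 _ (ℕₚ.m≤m+n d m)) ⟩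
    Σ< d a + 0ℚ                   ≡⟨ +-identityʳ _ ⟩
    Σ< d a                        ∎

Σ<-bound-irrelevant : ∀ {a d e} → VanishesFrom a d → VanishesFrom a e → Σ< d a ≡ Σ< e a
Σ<-bound-irrelevant {d = d} {e} a≡0ᵈ a≡0ᵉ with ℕₚ.≤-total d e
... | inj₁ d≤e = sym (Σ<-extend a≡0ᵈ d≤e)
... | inj₂ e≤d = Σ<-extend a≡0ᵉ e≤d

VanishesFrom-⊗ : ∀ {a b da db} → VanishesFrom a da → VanishesFrom b db →
  VanishesFrom (a ⊗ b) (da ℕ.+ db)
VanishesFrom-⊗ {a} {b} {da} {db} a≡0 b≡0 k da+db≤k = Σ<-zero (suc k) term
  where
  term : ∀ j → j < suc k → a j * b (k ∸ j) ≡ 0ℚ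
  term j _ with ℕₚ.≤-<-connex da j
  ... | inj₁ da≤j = trans (cong (_* b (k ∸ j)) (a≡0 j da≤j)) (*-zeroˡ (b (k ∸ j)))
  ... | inj₂ j<da = trans (cong (a j *_) (b≡0 (k ∸ j) db≤k∸j)) (*-zeroʳ (a j))
    where
    db≤k∸j : db ≤ k ∸ j
    db≤k∸j = ℕₚ.≤-trans (ℕₚ.≤-reflexive (sym (ℕₚ.m+n∸m≡n da db))) (ℕₚ.∸-mono da+db≤k (ℕₚ.<⇒≤ j<da))

Σ<-⊗ : ∀ {a b da db} → VanishesFrom a da → VanishesFrom b db →
  Σ< (da ℕ.+ db) (a ⊗ b) ≡ Σ< da a * Σ< db b
Σ<-⊗ {a} {b} {da} {db} a≡0 b≡0 = begin
  Σ< D (λ k → Σ< (suc k) (λ j → a j * b (k ∸ j)))  ≡⟨ Σ<-triangle D (λ j l → a j * b l) ⟩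
  Σ< D (λ j → Σ< (D ∸ j) (λ l → a j * b l))        ≡⟨ Σ<-cong D (λ j _ → Σ<-*ˡ (D ∸ j) (a j) b) ⟩
  Σ< D (λ j → a j * Σ< (D ∸ j) b)                  ≡⟨ Σ<-cong D column ⟩
  Σ< D (λ j → a j * Σ< db b)                       ≡⟨ Σ<-*ʳ D (Σ< db b) a ⟩
  Σ< D a * Σ< db b                                 ≡⟨ cong (_* Σ< db b) (Σ<-extend a≡0 (ℕₚ.m≤m+n da db)) ⟩
  Σ< da a * Σ< db b                                ∎
  where
  D = da ℕ.+ db
  column : ∀ j → j < D → a j * Σ< (D ∸ j) b ≡ a j * Σ< db b
  column j _ with ℕₚ.≤-<-connex da j
  ... | inj₁ da≤j = begin
    a j * Σ< (D ∸ j) b  ≡⟨ cong (_* Σ< (D ∸ j) b) (a≡0 j da≤j) ⟩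
    0ℚ * Σ< (D ∸ j) b   ≡⟨ *-zeroˡ (Σ< (D ∸ j) b) ⟩
    0ℚ                  ≡⟨ *-zeroˡ (Σ< db b) ⟨
    0ℚ * Σ< db b        ≡⟨ cong (_* Σ< db b) (a≡0 j da≤j) ⟨
    a j * Σ< db b       ∎
  ... | inj₂ j<da = cong (a j *_) (Σ<-extend b≡0 (ℕₚ.≤-trans (ℕₚ.≤-reflexive (sym (ℕₚ.m+n∸m≡n da db)))
                                                            (ℕₚ.∸-monoʳ-≤ D (ℕₚ.<⇒≤ j<da))))

ℕtoℚ-+ : ∀ m n → ℕtoℚ (m ℕ.+ n) ≡ ℕtoℚ m + ℕtoℚ n
ℕtoℚ-+ m n = sym (begin
  ℕtoℚ m + ℕtoℚ n                        ≡⟨ cong₂ _+_ (as-mkℚ m) (as-mkℚ n) ⟩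
  ((ℤ.+ m ℤ.* ℤ.+ 1) ℤ.+ (ℤ.+ n ℤ.* ℤ.+ 1)) / 1  ≡⟨ cong (_/ 1) (cong₂ ℤ._+_ (ℤₚ.*-identityʳ (ℤ.+ m))
                                                                       (ℤₚ.*-identityʳ (ℤ.+ n))) ⟩
  ℕtoℚ (m ℕ.+ n)                         ∎)
  where
  as-mkℚ : ∀ n → ℕtoℚ n ≡ mkℚ (ℤ.+ n) 0 (Coprimality.sym (Coprimality.1-coprimeTo n))
  as-mkℚ n = normalize-coprime (Coprimality.sym (Coprimality.1-coprimeTo n))

θₚ : PS → PS
θₚ a k = ℕtoℚ k * a k

θₚ-⊗ : ∀ a b → θₚ (a ⊗ b) ≈ₚ θₚ a ⊗ b ⊕ a ⊗ θₚ b
θₚ-⊗ a b k = begin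
  ℕtoℚ k * Σ< (suc k) (λ j → a j * b (k ∸ j))      ≡⟨ Σ<-*ˡ (suc k) (ℕtoℚ k) _ ⟨
  Σ< (suc k) (λ j → ℕtoℚ k * (a j * b (k ∸ j)))    ≡⟨ Σ<-cong (suc k) term ⟩
  Σ< (suc k) (λ j → ℕtoℚ j * a j * b (k ∸ j) + a j * (ℕtoℚ (k ∸ j) * b (k ∸ j)))
                                                   ≡⟨ Σ<-+ (suc k) _ _ ⟩
  (θₚ a ⊗ b ⊕ a ⊗ θₚ b) k                          ∎
  where
  term : ∀ j → j < suc k →
    ℕtoℚ k * (a j * b (k ∸ j)) ≡ ℕtoℚ j * a j * b (k ∸ j) + a j * (ℕtoℚ (k ∸ j) * b (k ∸ j))
  term j j<1+k = begin
    ℕtoℚ k * (A * B)                ≡⟨ cong (λ m → ℕtoℚ m * (A * B)) (ℕₚ.m+[n∸m]≡n (ℕₚ.≤-pred j<1+k)) ⟨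
    ℕtoℚ (j ℕ.+ (k ∸ j)) * (A * B)  ≡⟨ cong (_* (A * B)) (ℕtoℚ-+ j (k ∸ j)) ⟩
    (I + K) * (A * B)               ≡⟨ *-distribʳ-+ (A * B) I K ⟩
    I * (A * B) + K * (A * B)       ≡⟨ cong₂ _+_ (sym (*-assoc I A B)) (x∙yz≈y∙xz K A B) ⟩
    I * A * B + A * (K * B)         ∎
    where
    A = a j ; B = b (k ∸ j) ; I = ℕtoℚ j ; K = ℕtoℚ (k ∸ j)

Σℕ<-≥ : ∀ n (f : ℕ → ℕ) i → i < n → f i ≤ Σℕ< n f
Σℕ<-≥ (suc n) f i i<1+n with ℕₚ.m≤n⇒m<n∨m≡n (ℕₚ.≤-pred i<1+n)
... | inj₁ i<n  = ℕₚ.≤-trans (Σℕ<-≥ n f i i<n) (ℕₚ.m≤m+n (Σℕ< n f) (f n))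
... | inj₂ refl = ℕₚ.m≤n+m (f i) (Σℕ< n f)

bound : ∀ {B} → UFin B → ℕ → ℕ
bound finB n = proj₁ (finB n)

vanishes : ∀ {B} (finB : UFin B) n → VanishesFrom (B n) (bound finB n)
vanishes finB n = proj₂ (finB n)

at1-bound : ∀ {B} (finB : UFin B) n {d} → VanishesFrom (B n) d → at1 B finB n ≡ Σ< d (B n)
at1-bound finB n = Σ<-bound-irrelevant (vanishes finB n)

UFin-cong : ∀ {A B} → A ≈ B → UFin A → UFin B
UFin-cong A≈B finA n = bound finA n , λ k d≤k → trans (sym (A≈B n k)) (vanishes finA n k d≤k)

UFin-⊞ : ∀ {A B} → UFin A → UFin B → UFin (A ⊞ B)
UFin-⊞ finA finB n = bound finA n ℕ.+ bound finB n , λ k d≤k →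
  trans (cong₂ _+_ (vanishes finA n k (ℕₚ.≤-trans (ℕₚ.m≤m+n _ _) d≤k))
                   (vanishes finB n k (ℕₚ.≤-trans (ℕₚ.m≤n+m _ _) d≤k)))
        (+-identityˡ 0ℚ)

UFin-⊟ : ∀ {A B} → UFin A → UFin B → UFin (A ⊟ B)
UFin-⊟ finA finB n = bound finA n ℕ.+ bound finB n , λ k d≤k →
  trans (cong₂ ℚ._-_ (vanishes finA n k (ℕₚ.≤-trans (ℕₚ.m≤m+n _ _) d≤k))
                     (vanishes finB n k (ℕₚ.≤-trans (ℕₚ.m≤n+m _ _) d≤k)))
        (+-inverseʳ 0ℚ)

bound-⊠ : ∀ {A B} → UFin A → UFin B → ℕ → ℕ
bound-⊠ finA finB n = Σℕ< (suc n) λ i → bound finA i ℕ.+ bound finB (n ∸ i)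

vanishes-⊠ : ∀ {A B} (finA : UFin A) (finB : UFin B) n i → i < suc n →
  VanishesFrom (A i ⊗ B (n ∸ i)) (bound-⊠ finA finB n)
vanishes-⊠ finA finB n i i<1+n =
  VanishesFrom-mono (Σℕ<-≥ (suc n) (λ i → bound finA i ℕ.+ bound finB (n ∸ i)) i i<1+n)
                    (VanishesFrom-⊗ (vanishes finA i) (vanishes finB (n ∸ i)))

UFin-⊠ : ∀ {A B} → UFin A → UFin B → UFin (A ⊠ B)
UFin-⊠ finA finB n = bound-⊠ finA finB n , λ k d≤k →
  Σ<-zero (suc n) λ i i<1+n → vanishes-⊠ finA finB n i i<1+n k d≤k

UFin-zB : ∀ {A} → UFin A → UFin (zB A)
UFin-zB finA zero    = 0 , λ _ _ → refl
UFin-zB finA (suc n) = finA n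

UFin-oneB : UFin oneB
UFin-oneB zero    = 1 , λ { (suc k) _ → refl }
UFin-oneB (suc n) = 0 , λ _ _ → refl

at1-cong : ∀ {A B} → A ≈ B → (finA : UFin A) (finB : UFin B) → at1 A finA ≈ₚ at1 B finB
at1-cong {A} {B} A≈B finA finB n = begin
  Σ< (bound finA n) (A n)  ≡⟨ Σ<-cong (bound finA n) (λ k _ → A≈B n k) ⟩
  Σ< (bound finA n) (B n)  ≡⟨ at1-bound finB n (proj₂ (UFin-cong A≈B finA n)) ⟨
  at1 B finB n             ∎

at1-⊞ : ∀ {A B} (finA : UFin A) (finB : UFin B) (finA⊞B : UFin (A ⊞ B)) →
  at1 (A ⊞ B) finA⊞B ≈ₚ at1 A finA ⊕ at1 B finB
at1-⊞ {A} {B} finA finB finA⊞B n = begin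
  at1 (A ⊞ B) finA⊞B n                ≡⟨ at1-bound finA⊞B n (proj₂ (UFin-⊞ finA finB n)) ⟩
  Σ< d (λ k → A n k + B n k)          ≡⟨ Σ<-+ d (A n) (B n) ⟩
  Σ< d (A n) + Σ< d (B n)             ≡⟨ cong₂ _+_ (Σ<-extend (vanishes finA n) (ℕₚ.m≤m+n _ _))
                                                   (Σ<-extend (vanishes finB n) (ℕₚ.m≤n+m _ (bound finA n))) ⟩
  at1 A finA n + at1 B finB n         ∎
  where d = bound finA n ℕ.+ bound finB n

at1-⊟ : ∀ {A B} (finA : UFin A) (finB : UFin B) (finA⊟B : UFin (A ⊟ B)) →
  at1 (A ⊟ B) finA⊟B ≈ₚ at1 A finA ⊖ at1 B finB
at1-⊟ {A} {B} finA finB finA⊟B n = begin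
  at1 (A ⊟ B) finA⊟B n                ≡⟨ at1-bound finA⊟B n (proj₂ (UFin-⊟ finA finB n)) ⟩
  Σ< d (λ k → A n k + - B n k)        ≡⟨ Σ<-+ d (A n) (λ k → - B n k) ⟩
  Σ< d (A n) + Σ< d (λ k → - B n k)   ≡⟨ cong (Σ< d (A n) +_) (Σ<-neg d (B n)) ⟩
  Σ< d (A n) + - Σ< d (B n)           ≡⟨ cong₂ ℚ._-_ (Σ<-extend (vanishes finA n) (ℕₚ.m≤m+n _ _))
                                                     (Σ<-extend (vanishes finB n) (ℕₚ.m≤n+m _ (bound finA n))) ⟩
  at1 A finA n + - at1 B finB n       ∎
  where d = bound finA n ℕ.+ bound finB n

at1-⊠ : ∀ {A B} (finA : UFin A) (finB : UFin B) (finA⊠B : UFin (A ⊠ B)) →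
  at1 (A ⊠ B) finA⊠B ≈ₚ at1 A finA ⊗ at1 B finB
at1-⊠ {A} {B} finA finB finA⊠B n = begin
  at1 (A ⊠ B) finA⊠B n
    ≡⟨ at1-bound finA⊠B n (proj₂ (UFin-⊠ finA finB n)) ⟩
  Σ< d (λ k → Σ< (suc n) (λ i → (A i ⊗ B (n ∸ i)) k))
    ≡⟨ Σ<-swap d (suc n) (λ k i → (A i ⊗ B (n ∸ i)) k) ⟩
  Σ< (suc n) (λ i → Σ< d (A i ⊗ B (n ∸ i)))
    ≡⟨ Σ<-cong (suc n) term ⟩
  (at1 A finA ⊗ at1 B finB) n
    ∎
  where
  d = bound-⊠ finA finB n
  term : ∀ i → i < suc n → Σ< d (A i ⊗ B (n ∸ i)) ≡ at1 A finA i * at1 B finB (n ∸ i)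
  term i i<1+n = trans (Σ<-bound-irrelevant (vanishes-⊠ finA finB n i i<1+n)
                                            (VanishesFrom-⊗ (vanishes finA i) (vanishes finB (n ∸ i))))
                       (Σ<-⊗ (vanishes finA i) (vanishes finB (n ∸ i)))

at1-zB : ∀ {A} (finA : UFin A) (finzA : UFin (zB A)) → at1 (zB A) finzA ≈ₚ zₚ ⊗ at1 A finA
at1-zB {A} finA finzA zero    = trans (Σ<-zero (bound finzA 0) λ _ _ → refl) (sym (zₚ⊗-zero (at1 A finA)))
at1-zB {A} finA finzA (suc n) = trans (Σ<-bound-irrelevant (vanishes finzA (suc n)) (vanishes finA n))
                                      (sym (zₚ⊗-suc (at1 A finA) n))

at1-oneB : (fin1 : UFin oneB) → at1 oneB fin1 ≈ₚ 1P
at1-oneB fin1 zero    = trans (at1-bound fin1 0 (proj₂ (UFin-oneB 0))) (+-identityˡ 1ℚ)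
at1-oneB fin1 (suc n) = Σ<-zero (bound fin1 (suc n)) λ _ _ → refl

-- The Euler operator u ∂/∂u: du1 A is definitionally at1 (θ A), so the du1 lemmas reduce to
-- the at1 lemmas and the Leibniz rule θ-⊠.
θ : BS → BS
θ A n = θₚ (A n)

UFin-θ : ∀ {A} → UFin A → UFin (θ A)
UFin-θ finA n = bound finA n , λ k d≤k → trans (cong (ℕtoℚ k *_) (vanishes finA n k d≤k)) (*-zeroʳ (ℕtoℚ k))

du1-cong : ∀ {A B} → A ≈ B → (finA : UFin A) (finB : UFin B) → du1 A finA ≈ₚ du1 B finB
du1-cong A≈B finA finB = at1-cong (λ n k → cong (ℕtoℚ k *_) (A≈B n k)) (UFin-θ finA) (UFin-θ finB)

du1-⊞ : ∀ {A B} (finA : UFin A) (finB : UFin B) (finA⊞B : UFin (A ⊞ B)) →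
  du1 (A ⊞ B) finA⊞B ≈ₚ du1 A finA ⊕ du1 B finB
du1-⊞ {A} {B} finA finB finA⊞B = ≈ₚ-trans
  (at1-cong (λ n k → *-distribˡ-+ (ℕtoℚ k) (A n k) (B n k)) (UFin-θ finA⊞B) finθ)
  (at1-⊞ (UFin-θ finA) (UFin-θ finB) finθ)
  where finθ = UFin-⊞ (UFin-θ finA) (UFin-θ finB)

du1-⊟ : ∀ {A B} (finA : UFin A) (finB : UFin B) (finA⊟B : UFin (A ⊟ B)) →
  du1 (A ⊟ B) finA⊟B ≈ₚ du1 A finA ⊖ du1 B finB
du1-⊟ {A} {B} finA finB finA⊟B = ≈ₚ-trans
  (at1-cong θ-⊟ (UFin-θ finA⊟B) finθ)
  (at1-⊟ (UFin-θ finA) (UFin-θ finB) finθ)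
  where
  finθ = UFin-⊟ (UFin-θ finA) (UFin-θ finB)
  θ-⊟ : θ (A ⊟ B) ≈ θ A ⊟ θ B
  θ-⊟ n k = trans (*-distribˡ-+ (ℕtoℚ k) (A n k) (- B n k))
                  (cong (ℕtoℚ k * A n k +_) (sym (neg-distribʳ-* (ℕtoℚ k) (B n k))))

θ-⊠ : ∀ A B → θ (A ⊠ B) ≈ θ A ⊠ B ⊞ A ⊠ θ B
θ-⊠ A B n k = begin
  ℕtoℚ k * Σ< (suc n) (λ i → (A i ⊗ B (n ∸ i)) k)  ≡⟨ Σ<-*ˡ (suc n) (ℕtoℚ k) _ ⟨
  Σ< (suc n) (λ i → θₚ (A i ⊗ B (n ∸ i)) k)       ≡⟨ Σ<-cong (suc n) (λ i _ → θₚ-⊗ (A i) (B (n ∸ i)) k) ⟩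
  Σ< (suc n) (λ i → (θₚ (A i) ⊗ B (n ∸ i)) k + (A i ⊗ θₚ (B (n ∸ i))) k)
                                                  ≡⟨ Σ<-+ (suc n) _ _ ⟩
  (θ A ⊠ B ⊞ A ⊠ θ B) n k                         ∎

du1-⊠ : ∀ {A B} (finA : UFin A) (finB : UFin B) (finA⊠B : UFin (A ⊠ B)) →
  du1 (A ⊠ B) finA⊠B ≈ₚ du1 A finA ⊗ at1 B finB ⊕ at1 A finA ⊗ du1 B finB
du1-⊠ {A} {B} finA finB finA⊠B = ≈ₚ-trans
  (at1-cong (θ-⊠ A B) (UFin-θ finA⊠B) finθ)
  (≈ₚ-trans (at1-⊞ finθA⊠B finA⊠θB finθ)
            (⊕-cong (at1-⊠ (UFin-θ finA) finB finθA⊠B) (at1-⊠ finA (UFin-θ finB) finA⊠θB)))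
  where
  finθA⊠B = UFin-⊠ (UFin-θ finA) finB
  finA⊠θB = UFin-⊠ finA (UFin-θ finB)
  finθ = UFin-⊞ finθA⊠B finA⊠θB

du1-zB : ∀ {A} (finA : UFin A) (finzA : UFin (zB A)) → du1 (zB A) finzA ≈ₚ zₚ ⊗ du1 A finA
du1-zB {A} finA finzA = ≈ₚ-trans (at1-cong θ-zB (UFin-θ finzA) (UFin-zB (UFin-θ finA)))
                                 (at1-zB (UFin-θ finA) (UFin-zB (UFin-θ finA)))
  where
  θ-zB : θ (zB A) ≈ zB (θ A)
  θ-zB zero    k = *-zeroʳ (ℕtoℚ k)
  θ-zB (suc n) k = refl

du1-oneB : (fin1 : UFin oneB) → du1 oneB fin1 ≈ₚ 0P
du1-oneB fin1 n = trans (Σ<-zero (bound fin1 n) λ k _ → θ-oneB n k) (sym (cst-0 n))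
  where
  θ-oneB : ∀ n k → θ oneB n k ≡ 0ℚ
  θ-oneB zero    zero    = *-zeroˡ 1ℚ
  θ-oneB zero    (suc k) = *-zeroʳ (ℕtoℚ (suc k))
  θ-oneB (suc n) k       = *-zeroʳ (ℕtoℚ k)

Σℕ<-mono : ∀ {m n} (f : ℕ → ℕ) → m ≤ n → Σℕ< m f ≤ Σℕ< n f
Σℕ<-mono {n = zero}  f z≤n = ℕₚ.≤-refl
Σℕ<-mono {m} {suc n} f m≤1+n with ℕₚ.m≤n⇒m<n∨m≡n m≤1+n
... | inj₁ m<1+n = ℕₚ.≤-trans (Σℕ<-mono f (ℕₚ.≤-pred m<1+n)) (ℕₚ.m≤m+n (Σℕ< n f) (f n))
... | inj₂ refl  = ℕₚ.≤-refl

-- With d i the u-degree bound of w i, the z^m coefficient of v = w + w v has u-degree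
-- below (m + 1) (d 0 + ⋯ + d m), by strong induction on m since w has no z^0 term.
UFin-geometric : ∀ {w v} → UFin w → (∀ k → w 0 k ≡ 0ℚ) → v ≈ w ⊞ w ⊠ v → UFin v
UFin-geometric {w} {v} finw w₀≡0 v≈w+wv n = C n , <-rec (λ m → VanishesFrom (v m) (C m)) step n
  where
  D C : ℕ → ℕ
  D m = Σℕ< (suc m) (bound finw)
  C m = suc m ℕ.* D m
  step : ∀ m → (∀ {j} → j < m → VanishesFrom (v j) (C j)) → VanishesFrom (v m) (C m)
  step m ih k C≤k = begin
    v m k                                                        ≡⟨ v≈w+wv m k ⟩
    w m k + Σ< (suc m) (λ i → (w i ⊗ v (m ∸ i)) k)               ≡⟨ cong₂ _+_ (vanishes finw m k wₘ-bound)
                                                                               (Σ<-zero (suc m) term) ⟩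
    0ℚ + 0ℚ                                                      ≡⟨ +-identityˡ 0ℚ ⟩
    0ℚ                                                           ∎
    where
    wₘ-bound : bound finw m ≤ k
    wₘ-bound = ℕₚ.≤-trans (Σℕ<-≥ (suc m) (bound finw) m ℕₚ.≤-refl) (ℕₚ.≤-trans (ℕₚ.m≤m+n (D m) _) C≤k)
    term : ∀ i → i < suc m → (w i ⊗ v (m ∸ i)) k ≡ 0ℚ
    term zero    _ = Σ<-zero (suc k) λ j _ → trans (cong (_* v m (k ∸ j)) (w₀≡0 j)) (*-zeroˡ (v m (k ∸ j)))
    term (suc i) (s≤s i<m) = VanishesFrom-⊗ (vanishes finw (suc i)) (ih m∸1+i<m) k (ℕₚ.≤-trans degree C≤k)
      where
      m∸1+i<m : m ∸ suc i < m
      m∸1+i<m = ℕₚ.∸-monoʳ-< {o = 0} (s≤s z≤n) i<m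
      degree : bound finw (suc i) ℕ.+ C (m ∸ suc i) ≤ C m
      degree = ℕₚ.+-mono-≤ (Σℕ<-≥ (suc m) (bound finw) (suc i) (s≤s i<m))
                           (ℕₚ.*-mono-≤ m∸1+i<m (Σℕ<-mono (bound finw) (s≤s (ℕₚ.m∸n≤m m (suc i)))))

UFin-IsK : ∀ K {w v} → UFin (zB w) → IsK K (zB w) v → UFin v
UFin-IsK Kall finzw v≈ = UFin-geometric finzw (λ _ → refl) v≈
UFin-IsK K2   finzw v≈ = UFin-cong (λ n k → sym (v≈ n k)) (UFin-⊠ finzw finzw)
UFin-IsK K12  finzw v≈ = UFin-cong (λ n k → sym (v≈ n k)) (UFin-⊞ finzw (UFin-⊠ finzw finzw))
UFin-IsK K1   finzw v≈ = UFin-cong (λ n k → sym (v≈ n k)) finzw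

record At1 (A : BS) (a a′ : PS) : Set where
  field
    finite : UFin A
    at1≈   : at1 A finite ≈ₚ a
    du1≈   : du1 A finite ≈ₚ a′

open At1

at1-At1 : ∀ {A} (finA : UFin A) → At1 A (at1 A finA) (du1 A finA)
at1-At1 finA = record { finite = finA ; at1≈ = ≈ₚ-refl ; du1≈ = ≈ₚ-refl }

At1-unique : ∀ {A a a′ b b′} → At1 A a a′ → At1 A b b′ → a ≈ₚ b × a′ ≈ₚ b′
At1-unique Aa Ab =
  ≈ₚ-trans (≈ₚ-sym (at1≈ Aa)) (≈ₚ-trans (at1-cong (λ _ _ → refl) (finite Aa) (finite Ab)) (at1≈ Ab)) ,
  ≈ₚ-trans (≈ₚ-sym (du1≈ Aa)) (≈ₚ-trans (du1-cong (λ _ _ → refl) (finite Aa) (finite Ab)) (du1≈ Ab))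

At1-cong : ∀ {A B a a′} → A ≈ B → At1 A a a′ → At1 B a a′
At1-cong A≈B Aa = record
  { finite = finB
  ; at1≈   = ≈ₚ-trans (at1-cong (λ n k → sym (A≈B n k)) finB (finite Aa)) (at1≈ Aa)
  ; du1≈   = ≈ₚ-trans (du1-cong (λ n k → sym (A≈B n k)) finB (finite Aa)) (du1≈ Aa) }
  where finB = UFin-cong A≈B (finite Aa)

At1-⊞ : ∀ {A B a a′ b b′} → At1 A a a′ → At1 B b b′ → At1 (A ⊞ B) (a ⊕ b) (a′ ⊕ b′)
At1-⊞ Aa Bb = record
  { finite = fin
  ; at1≈   = ≈ₚ-trans (at1-⊞ (finite Aa) (finite Bb) fin) (⊕-cong (at1≈ Aa) (at1≈ Bb))
  ; du1≈   = ≈ₚ-trans (du1-⊞ (finite Aa) (finite Bb) fin) (⊕-cong (du1≈ Aa) (du1≈ Bb)) }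
  where fin = UFin-⊞ (finite Aa) (finite Bb)

At1-⊟ : ∀ {A B a a′ b b′} → At1 A a a′ → At1 B b b′ → At1 (A ⊟ B) (a ⊖ b) (a′ ⊖ b′)
At1-⊟ Aa Bb = record
  { finite = fin
  ; at1≈   = ≈ₚ-trans (at1-⊟ (finite Aa) (finite Bb) fin) (⊖-cong (at1≈ Aa) (at1≈ Bb))
  ; du1≈   = ≈ₚ-trans (du1-⊟ (finite Aa) (finite Bb) fin) (⊖-cong (du1≈ Aa) (du1≈ Bb)) }
  where fin = UFin-⊟ (finite Aa) (finite Bb)

At1-⊠ : ∀ {A B a a′ b b′} → At1 A a a′ → At1 B b b′ → At1 (A ⊠ B) (a ⊗ b) (a′ ⊗ b ⊕ a ⊗ b′)
At1-⊠ Aa Bb = record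
  { finite = fin
  ; at1≈   = ≈ₚ-trans (at1-⊠ (finite Aa) (finite Bb) fin) (⊗-cong (at1≈ Aa) (at1≈ Bb))
  ; du1≈   = ≈ₚ-trans (du1-⊠ (finite Aa) (finite Bb) fin)
                       (⊕-cong (⊗-cong (du1≈ Aa) (at1≈ Bb)) (⊗-cong (at1≈ Aa) (du1≈ Bb))) }
  where fin = UFin-⊠ (finite Aa) (finite Bb)

At1-zB : ∀ {A a a′} → At1 A a a′ → At1 (zB A) (zₚ ⊗ a) (zₚ ⊗ a′)
At1-zB Aa = record
  { finite = fin
  ; at1≈   = ≈ₚ-trans (at1-zB (finite Aa) fin) (⊗-cong {zₚ} ≈ₚ-refl (at1≈ Aa))
  ; du1≈   = ≈ₚ-trans (du1-zB (finite Aa) fin) (⊗-cong {zₚ} ≈ₚ-refl (du1≈ Aa)) }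
  where fin = UFin-zB (finite Aa)

At1-oneB : At1 oneB 1P 0P
At1-oneB = record { finite = UFin-oneB ; at1≈ = at1-oneB UFin-oneB ; du1≈ = du1-oneB UFin-oneB }

-- v = K(w) and its u-derivative v′ = K′(w) w′; for 𝒦 = ℕ* the derivative of v = w + w v.
IsK-at1 : KType → (w v w′ v′ : PS) → Set
IsK-at1 Kall w v w′ v′ = v ≈ₚ w ⊕ w ⊗ v × v′ ≈ₚ w′ ⊕ (w′ ⊗ v ⊕ w ⊗ v′)
IsK-at1 K2   w v w′ v′ = v ≈ₚ w ⊗ w × v′ ≈ₚ w′ ⊗ w ⊕ w ⊗ w′
IsK-at1 K12  w v w′ v′ = v ≈ₚ w ⊕ w ⊗ w × v′ ≈ₚ w′ ⊕ (w′ ⊗ w ⊕ w ⊗ w′)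
IsK-at1 K1   w v w′ v′ = v ≈ₚ w × v′ ≈ₚ w′

at1-IsK : ∀ K {w v W W′ V V′} → IsK K w v → At1 w W W′ → At1 v V V′ → IsK-at1 K W V W′ V′
at1-IsK Kall v≈ Ww Vv = At1-unique Vv (At1-cong (λ n k → sym (v≈ n k)) (At1-⊞ Ww (At1-⊠ Ww Vv)))
at1-IsK K2   v≈ Ww Vv = At1-unique Vv (At1-cong (λ n k → sym (v≈ n k)) (At1-⊠ Ww Ww))
at1-IsK K12  v≈ Ww Vv = At1-unique Vv (At1-cong (λ n k → sym (v≈ n k)) (At1-⊞ Ww (At1-⊠ Ww Ww)))
at1-IsK K1   v≈ Ww Vv = At1-unique Vv (At1-cong (λ n k → sym (v≈ n k)) Ww)

-- IsClassGF at u = 1: G, G′ are the value and u-derivative of the flower series, y, y′ those of f.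
IsClass-at1 : KType → Cls → (G G′ y y′ : PS) → Set
IsClass-at1 K clsR G G′ r r′ = Σ PS λ v → Σ PS λ v′ →
  IsK-at1 K (zₚ ⊗ r) v (zₚ ⊗ r′) v′ × r ≈ₚ G ⊕ v × r′ ≈ₚ G′ ⊕ v′
IsClass-at1 K clsS G G′ s s′ = Σ PS λ v → Σ PS λ v′ →
  IsK-at1 K (zₚ ⊗ (G ⊗ s)) v (zₚ ⊗ (G′ ⊗ s ⊕ G ⊗ s′)) v′ × s ≈ₚ 1P ⊕ v × s′ ≈ₚ 0P ⊕ v′
IsClass-at1 K clsT G G′ t t′ = Σ PS λ s → Σ PS λ s′ →
  IsClass-at1 K clsS G G′ s s′ × t ≈ₚ G ⊗ s × t′ ≈ₚ G′ ⊗ s ⊕ G ⊗ s′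

at1-IsClassS : ∀ K {P G G′ s v} (fins : UFin s) → At1 P G G′ →
  IsK K (zB (P ⊠ s)) v → s ≈ oneB ⊞ v → IsClass-at1 K clsS G G′ (at1 s fins) (du1 s fins)
at1-IsClassS K fins PG v≈ s≈ = at1 _ finv , du1 _ finv ,
  at1-IsK K v≈ (At1-zB (At1-⊠ PG (at1-At1 fins))) (at1-At1 finv) ,
  At1-unique (at1-At1 fins) (At1-cong (λ n k → sym (s≈ n k)) (At1-⊞ At1-oneB (at1-At1 finv)))
  where finv = UFin-IsK K (UFin-zB (UFin-⊠ (finite PG) fins)) v≈

at1-IsClassGF : ∀ K cls {P G G′ f} (finf : UFin f) → At1 P G G′ →
  IsClassGF K cls P f → IsClass-at1 K cls G G′ (at1 f finf) (du1 f finf)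
at1-IsClassGF K clsR finf PG (v , v≈ , f≈) = at1 _ finv , du1 _ finv ,
  at1-IsK K v≈ (At1-zB (at1-At1 finf)) (at1-At1 finv) ,
  At1-unique (at1-At1 finf) (At1-cong (λ n k → sym (f≈ n k)) (At1-⊞ PG (at1-At1 finv)))
  where finv = UFin-IsK K (UFin-zB finf) v≈
at1-IsClassGF K clsS finf PG (v , v≈ , f≈) = at1-IsClassS K finf PG v≈ f≈
at1-IsClassGF K clsT finf PG (s , v , v≈ , s≈ , f≈) = at1 s fins , du1 s fins ,
  at1-IsClassS K fins PG v≈ s≈ ,
  At1-unique (at1-At1 finf) (At1-cong (λ n k → sym (f≈ n k)) (At1-⊠ PG (at1-At1 fins)))
  where
  finv = UFin-IsK K (UFin-zB (UFin-cong f≈ finf)) v≈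
  fins = UFin-cong (λ n k → sym (s≈ n k)) (UFin-⊞ UFin-oneB finv)

formula-Kall-R : ∀ {G G′ r Ω} → IsClass-at1 Kall clsR G G′ r Ω → Formula Kall clsR G G′ Ω
formula-Kall-R {G} {G′} {r} {Ω} (v , v′ , (v≈ , v′≈) , r≈ , Ω≈) s √Δ = by-combination _
  (solve 6 (λ G G′ Ω r s z → let σ = ν 1 :- z :* (ν 1 :- G :+ ν 2 :* r) in
     ν 2 :* s :* Ω :- ((ν 1 :+ z :- z :* G) :* G′ :+ s :* G′)
       := ν 2 :* (σ :* Ω :- (ν 1 :- z :* r) :* G′) :+ (G′ :- ν 2 :* Ω) :* (σ :- s))
     (λ _ → refl) G G′ Ω r s zₚ)
  (nat 2 · slope ⊕₀ (G′ ⊖ nat 2 ⊗ Ω) · σ≈s)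
  where
  σ = nat 1 ⊖ zₚ ⊗ (nat 1 ⊖ G ⊕ nat 2 ⊗ r)
  slope : σ ⊗ Ω ≈ₚ (nat 1 ⊖ zₚ ⊗ r) ⊗ G′
  slope = by-combination _
    (solve 7 (λ G G′ Ω r v v′ z → let σ = ν 1 :- z :* (ν 1 :- G :+ ν 2 :* r) in
       σ :* Ω :- (ν 1 :- z :* r) :* G′
         := (ν 1 :- z :* r) :* (Ω :- (G′ :+ v′)) :+ ν 1 :* (v′ :- (z :* Ω :+ (z :* Ω :* v :+ z :* r :* v′)))
            :+ (:- (z :* Ω)) :* (r :- (G :+ v)))
       (λ _ → refl) G G′ Ω r v v′ zₚ)
    ((nat 1 ⊖ zₚ ⊗ r) · Ω≈ ⊕₀ nat 1 · v′≈ ⊕₀ negₚ (zₚ ⊗ Ω) · r≈)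
  σ≈s : σ ≈ₚ s
  σ≈s = IsSqrt-unique-1-z⊗ (nat 1 ⊖ G ⊕ nat 2 ⊗ r) (by-combination _
    (solve 4 (λ G r v z → let σ = ν 1 :- z :* (ν 1 :- G :+ ν 2 :* r) in
       σ :* σ :- (z :* z :* G :* G :- ν 2 :* (z :+ z :* z) :* G :+ (ν 1 :- z) :* (ν 1 :- z))
         := (:- (ν 4 :* z)) :* (v :- (z :* r :+ z :* r :* v))
            :+ (:- (ν 4 :* z :* (ν 1 :- z :* r))) :* (r :- (G :+ v)))
       (λ _ → refl) G r v zₚ)
    (negₚ (nat 4 ⊗ zₚ) · v≈ ⊕₀ negₚ (nat 4 ⊗ zₚ ⊗ (nat 1 ⊖ zₚ ⊗ r)) · r≈)) √Δ

Kall-S-equations : ∀ {G G′ y y′} → IsClass-at1 Kall clsS G G′ y y′ →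
  y ≈ₚ nat 1 ⊕ zₚ ⊗ G ⊗ y ⊗ y × (nat 1 ⊖ zₚ ⊗ (nat 2 ⊗ G ⊗ y)) ⊗ y′ ≈ₚ zₚ ⊗ G′ ⊗ y ⊗ y
Kall-S-equations {G} {G′} {y} {y′} (v , v′ , (v≈ , v′≈) , y≈ , y′≈) =
  by-combination _
    (solve 4 (λ G y v z →
       y :- (ν 1 :+ z :* G :* y :* y)
         := (ν 1 :- z :* (G :* y)) :* (y :- (ν 1 :+ v)) :+ ν 1 :* (v :- (z :* (G :* y) :+ z :* (G :* y) :* v)))
       (λ _ → refl) G y v zₚ)
    ((nat 1 ⊖ zₚ ⊗ (G ⊗ y)) · y≈ ⊕₀ nat 1 · v≈) ,
  by-combination _
    (solve 7 (λ G G′ y y′ v v′ z → let w = z :* (G :* y) ; w′ = z :* (G′ :* y :+ G :* y′) in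
       (ν 1 :- z :* (ν 2 :* G :* y)) :* y′ :- z :* G′ :* y :* y
         := ν 1 :* (v′ :- (w′ :+ (w′ :* v :+ w :* v′))) :+ (ν 1 :- w) :* (y′ :- (ν 0 :+ v′))
            :+ (:- w′) :* (y :- (ν 1 :+ v)))
       (λ _ → refl) G G′ y y′ v v′ zₚ)
    (nat 1 · v′≈ ⊕₀ (nat 1 ⊖ zₚ ⊗ (G ⊗ y)) · y′≈ ⊕₀ negₚ (zₚ ⊗ (G′ ⊗ y ⊕ G ⊗ y′)) · y≈)

Kall-S-root : ∀ G {y s} → y ≈ₚ nat 1 ⊕ zₚ ⊗ G ⊗ y ⊗ y → IsSqrt s (nat 1 ⊖ nat 4 ⊗ zₚ ⊗ G) →
  nat 1 ⊖ zₚ ⊗ (nat 2 ⊗ G ⊗ y) ≈ₚ s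
Kall-S-root G {y} value = IsSqrt-unique-1-z⊗ (nat 2 ⊗ G ⊗ y) (by-combination _
  (solve 3 (λ G y z → let σ = ν 1 :- z :* (ν 2 :* G :* y) in
     σ :* σ :- (ν 1 :- ν 4 :* z :* G) := (:- (ν 4 :* z :* G)) :* (y :- (ν 1 :+ z :* G :* y :* y)))
     (λ _ → refl) G y zₚ)
  (negₚ (nat 4 ⊗ zₚ ⊗ G) · value))

formula-Kall-S : ∀ {G G′ y y′} → IsClass-at1 Kall clsS G G′ y y′ → Formula Kall clsS G G′ y′
formula-Kall-S {G} {G′} {y} {y′} eqs s √Δ = by-combination _
  (solve 6 (λ G G′ y y′ s z → let σ = ν 1 :- z :* (ν 2 :* G :* y) in
     ν 2 :* z :* G :* G :* s :* y′ :- ((ν 1 :- ν 2 :* z :* G) :* G′ :- s :* G′)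
       := (:- (ν 2 :* z :* G :* G′)) :* (y :- (ν 1 :+ z :* G :* y :* y))
          :+ ν 2 :* z :* G :* G :* (σ :* y′ :- z :* G′ :* y :* y)
          :+ (:- (ν 2 :* z :* G :* G :* y′ :+ G′)) :* (σ :- s))
     (λ _ → refl) G G′ y y′ s zₚ)
  (negₚ (nat 2 ⊗ zₚ ⊗ G ⊗ G′) · value ⊕₀ nat 2 ⊗ zₚ ⊗ G ⊗ G · slope
    ⊕₀ negₚ (nat 2 ⊗ zₚ ⊗ G ⊗ G ⊗ y′ ⊕ G′) · σ≈s)
  where
  value = proj₁ (Kall-S-equations {G} {G′} eqs)
  slope = proj₂ (Kall-S-equations {G} {G′} eqs)
  σ≈s : nat 1 ⊖ zₚ ⊗ (nat 2 ⊗ G ⊗ y) ≈ₚ s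
  σ≈s = Kall-S-root G value √Δ

formula-Kall-T : ∀ {G G′ t Ω} → IsClass-at1 Kall clsT G G′ t Ω → Formula Kall clsT G G′ Ω
formula-Kall-T {G} {G′} {Ω = Ω} (y , y′ , eqs , _ , Ω≈) s √Δ = by-combination _
  (solve 7 (λ G G′ Ω y y′ s z → let σ = ν 1 :- z :* (ν 2 :* G :* y) in
     s :* Ω :- G′
       := G′ :* (y :- (ν 1 :+ z :* G :* y :* y)) :+ G :* (σ :* y′ :- z :* G′ :* y :* y)
          :+ σ :* (Ω :- (G′ :* y :+ G :* y′)) :+ (:- Ω) :* (σ :- s))
     (λ _ → refl) G G′ Ω y y′ s zₚ)
  (G′ · value ⊕₀ G · slope ⊕₀ (nat 1 ⊖ zₚ ⊗ (nat 2 ⊗ G ⊗ y)) · Ω≈ ⊕₀ negₚ Ω · σ≈s)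
  where
  value = proj₁ (Kall-S-equations {G} {G′} eqs)
  slope = proj₂ (Kall-S-equations {G} {G′} eqs)
  σ≈s : nat 1 ⊖ zₚ ⊗ (nat 2 ⊗ G ⊗ y) ≈ₚ s
  σ≈s = Kall-S-root G value √Δ

formula-K2-R : ∀ {G G′ r Ω} → IsClass-at1 K2 clsR G G′ r Ω → Formula K2 clsR G G′ Ω
formula-K2-R {G} {G′} {r} {Ω} (v , v′ , (v≈ , v′≈) , r≈ , Ω≈) s √Δ =
  ≈ₚ-trans (⊗-cong {b = Ω} (≈ₚ-sym σ≈s) ≈ₚ-refl) slope
  where
  σ = nat 1 ⊖ zₚ ⊗ (nat 2 ⊗ zₚ ⊗ r)
  slope : σ ⊗ Ω ≈ₚ G′
  slope = by-combination _
    (solve 5 (λ G′ Ω r v′ z → let σ = ν 1 :- z :* (ν 2 :* z :* r) in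
       σ :* Ω :- G′
         := ν 1 :* (Ω :- (G′ :+ v′)) :+ ν 1 :* (v′ :- (z :* Ω :* (z :* r) :+ z :* r :* (z :* Ω))))
       (λ _ → refl) G′ Ω r v′ zₚ)
    (nat 1 · Ω≈ ⊕₀ nat 1 · v′≈)
  σ≈s : σ ≈ₚ s
  σ≈s = IsSqrt-unique-1-z⊗ (nat 2 ⊗ zₚ ⊗ r) (by-combination _
    (solve 4 (λ G r v z → let σ = ν 1 :- z :* (ν 2 :* z :* r) in
       σ :* σ :- (ν 1 :- ν 4 :* z :* z :* G)
         := (:- (ν 4 :* z :* z)) :* (r :- (G :+ v)) :+ (:- (ν 4 :* z :* z)) :* (v :- z :* r :* (z :* r)))
       (λ _ → refl) G r v zₚ)
    (negₚ (nat 4 ⊗ zₚ ⊗ zₚ) · r≈ ⊕₀ negₚ (nat 4 ⊗ zₚ ⊗ zₚ) · v≈)) √Δ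

K2-S-equations : ∀ {G G′ y y′} → IsClass-at1 K2 clsS G G′ y y′ →
  y ≈ₚ nat 1 ⊕ zₚ ⊗ zₚ ⊗ G ⊗ G ⊗ y ⊗ y ×
  (nat 1 ⊖ zₚ ⊗ (nat 2 ⊗ zₚ ⊗ G ⊗ G ⊗ y)) ⊗ y′ ≈ₚ nat 2 ⊗ zₚ ⊗ zₚ ⊗ G ⊗ G′ ⊗ y ⊗ y
K2-S-equations {G} {G′} {y} {y′} (v , v′ , (v≈ , v′≈) , y≈ , y′≈) =
  by-combination _
    (solve 4 (λ G y v z → let w = z :* (G :* y) in
       y :- (ν 1 :+ z :* z :* G :* G :* y :* y) := ν 1 :* (y :- (ν 1 :+ v)) :+ ν 1 :* (v :- w :* w))
       (λ _ → refl) G y v zₚ)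
    (nat 1 · y≈ ⊕₀ nat 1 · v≈) ,
  by-combination _
    (solve 6 (λ G G′ y y′ v′ z → let w = z :* (G :* y) ; w′ = z :* (G′ :* y :+ G :* y′) in
       (ν 1 :- z :* (ν 2 :* z :* G :* G :* y)) :* y′ :- ν 2 :* z :* z :* G :* G′ :* y :* y
         := ν 1 :* (y′ :- (ν 0 :+ v′)) :+ ν 1 :* (v′ :- (w′ :* w :+ w :* w′)))
       (λ _ → refl) G G′ y y′ v′ zₚ)
    (nat 1 · y′≈ ⊕₀ nat 1 · v′≈)

K2-S-root : ∀ G {y s} → y ≈ₚ nat 1 ⊕ zₚ ⊗ zₚ ⊗ G ⊗ G ⊗ y ⊗ y →
  IsSqrt s (nat 1 ⊖ nat 4 ⊗ zₚ ⊗ zₚ ⊗ G ⊗ G) → nat 1 ⊖ zₚ ⊗ (nat 2 ⊗ zₚ ⊗ G ⊗ G ⊗ y) ≈ₚ s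
K2-S-root G {y} value = IsSqrt-unique-1-z⊗ (nat 2 ⊗ zₚ ⊗ G ⊗ G ⊗ y) (by-combination _
  (solve 3 (λ G y z → let σ = ν 1 :- z :* (ν 2 :* z :* G :* G :* y) in
     σ :* σ :- (ν 1 :- ν 4 :* z :* z :* G :* G)
       := (:- (ν 4 :* z :* z :* G :* G)) :* (y :- (ν 1 :+ z :* z :* G :* G :* y :* y)))
     (λ _ → refl) G y zₚ)
  (negₚ (nat 4 ⊗ zₚ ⊗ zₚ ⊗ G ⊗ G) · value))

formula-K2-S : ∀ {G G′ y y′} → IsClass-at1 K2 clsS G G′ y y′ → Formula K2 clsS G G′ y′
formula-K2-S {G} {G′} {y} {y′} eqs s √Δ = by-combination _
  (solve 6 (λ G G′ y y′ s z → let σ = ν 1 :- z :* (ν 2 :* z :* G :* G :* y) in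
     z :* z :* G :* G :* G :* s :* y′ :- ((ν 1 :- ν 2 :* z :* z :* G :* G) :* G′ :- s :* G′)
       := (:- (ν 2 :* z :* z :* G :* G :* G′)) :* (y :- (ν 1 :+ z :* z :* G :* G :* y :* y))
          :+ z :* z :* G :* G :* G :* (σ :* y′ :- ν 2 :* z :* z :* G :* G′ :* y :* y)
          :+ (:- (z :* z :* G :* G :* G :* y′ :+ G′)) :* (σ :- s))
     (λ _ → refl) G G′ y y′ s zₚ)
  (negₚ (nat 2 ⊗ zₚ ⊗ zₚ ⊗ G ⊗ G ⊗ G′) · value ⊕₀ zₚ ⊗ zₚ ⊗ G ⊗ G ⊗ G · slope
    ⊕₀ negₚ (zₚ ⊗ zₚ ⊗ G ⊗ G ⊗ G ⊗ y′ ⊕ G′) · σ≈s)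
  where
  value = proj₁ (K2-S-equations {G} {G′} eqs)
  slope = proj₂ (K2-S-equations {G} {G′} eqs)
  σ≈s : nat 1 ⊖ zₚ ⊗ (nat 2 ⊗ zₚ ⊗ G ⊗ G ⊗ y) ≈ₚ s
  σ≈s = K2-S-root G value √Δ

formula-K2-T : ∀ {G G′ t Ω} → IsClass-at1 K2 clsT G G′ t Ω → Formula K2 clsT G G′ Ω
formula-K2-T {G} {G′} {Ω = Ω} (y , y′ , eqs , _ , Ω≈) s √Δ = by-combination _
  (solve 7 (λ G G′ Ω y y′ s z → let σ = ν 1 :- z :* (ν 2 :* z :* G :* G :* y) in
     ν 2 :* z :* z :* G :* G :* s :* Ω :- (G′ :- s :* G′)
       := ν 2 :* z :* z :* G :* G :* G :* (σ :* y′ :- ν 2 :* z :* z :* G :* G′ :* y :* y)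
          :+ ν 2 :* z :* z :* G :* G :* σ :* (Ω :- (G′ :* y :+ G :* y′))
          :+ (:- (ν 2 :* z :* z :* G :* G :* Ω :+ G′)) :* (σ :- s))
     (λ _ → refl) G G′ Ω y y′ s zₚ)
  (nat 2 ⊗ zₚ ⊗ zₚ ⊗ G ⊗ G ⊗ G · slope ⊕₀ nat 2 ⊗ zₚ ⊗ zₚ ⊗ G ⊗ G ⊗ σ · Ω≈
    ⊕₀ negₚ (nat 2 ⊗ zₚ ⊗ zₚ ⊗ G ⊗ G ⊗ Ω ⊕ G′) · σ≈s)
  where
  σ = nat 1 ⊖ zₚ ⊗ (nat 2 ⊗ zₚ ⊗ G ⊗ G ⊗ y)
  slope = proj₂ (K2-S-equations {G} {G′} eqs)
  σ≈s : σ ≈ₚ s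
  σ≈s = K2-S-root G (proj₁ (K2-S-equations {G} {G′} eqs)) √Δ

formula-K12-R : ∀ {G G′ r Ω} → IsClass-at1 K12 clsR G G′ r Ω → Formula K12 clsR G G′ Ω
formula-K12-R {G} {G′} {r} {Ω} (v , v′ , (v≈ , v′≈) , r≈ , Ω≈) s √Δ =
  ≈ₚ-trans (⊗-cong {b = Ω} (≈ₚ-sym σ≈s) ≈ₚ-refl) slope
  where
  σ = nat 1 ⊖ zₚ ⊗ (nat 1 ⊕ nat 2 ⊗ zₚ ⊗ r)
  slope : σ ⊗ Ω ≈ₚ G′
  slope = by-combination _
    (solve 5 (λ G′ Ω r v′ z → let σ = ν 1 :- z :* (ν 1 :+ ν 2 :* z :* r) in
       σ :* Ω :- G′
         := ν 1 :* (Ω :- (G′ :+ v′)) :+ ν 1 :* (v′ :- (z :* Ω :+ (z :* Ω :* (z :* r) :+ z :* r :* (z :* Ω)))))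
       (λ _ → refl) G′ Ω r v′ zₚ)
    (nat 1 · Ω≈ ⊕₀ nat 1 · v′≈)
  σ≈s : σ ≈ₚ s
  σ≈s = IsSqrt-unique-1-z⊗ (nat 1 ⊕ nat 2 ⊗ zₚ ⊗ r) (by-combination _
    (solve 4 (λ G r v z → let σ = ν 1 :- z :* (ν 1 :+ ν 2 :* z :* r) in
       σ :* σ :- ((ν 1 :- z) :* (ν 1 :- z) :- ν 4 :* z :* z :* G)
         := (:- (ν 4 :* z :* z)) :* (r :- (G :+ v))
            :+ (:- (ν 4 :* z :* z)) :* (v :- (z :* r :+ z :* r :* (z :* r))))
       (λ _ → refl) G r v zₚ)
    (negₚ (nat 4 ⊗ zₚ ⊗ zₚ) · r≈ ⊕₀ negₚ (nat 4 ⊗ zₚ ⊗ zₚ) · v≈)) √Δ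

K12-S-equations : ∀ {G G′ y y′} → IsClass-at1 K12 clsS G G′ y y′ →
  y ≈ₚ nat 1 ⊕ zₚ ⊗ G ⊗ y ⊕ zₚ ⊗ zₚ ⊗ G ⊗ G ⊗ y ⊗ y ×
  (nat 1 ⊖ zₚ ⊗ (G ⊕ nat 2 ⊗ zₚ ⊗ G ⊗ G ⊗ y)) ⊗ y′ ≈ₚ zₚ ⊗ G′ ⊗ y ⊗ (nat 1 ⊕ nat 2 ⊗ zₚ ⊗ G ⊗ y)
K12-S-equations {G} {G′} {y} {y′} (v , v′ , (v≈ , v′≈) , y≈ , y′≈) =
  by-combination _
    (solve 4 (λ G y v z → let w = z :* (G :* y) in
       y :- (ν 1 :+ z :* G :* y :+ z :* z :* G :* G :* y :* y)
         := ν 1 :* (y :- (ν 1 :+ v)) :+ ν 1 :* (v :- (w :+ w :* w)))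
       (λ _ → refl) G y v zₚ)
    (nat 1 · y≈ ⊕₀ nat 1 · v≈) ,
  by-combination _
    (solve 6 (λ G G′ y y′ v′ z → let w = z :* (G :* y) ; w′ = z :* (G′ :* y :+ G :* y′) in
       (ν 1 :- z :* (G :+ ν 2 :* z :* G :* G :* y)) :* y′ :- z :* G′ :* y :* (ν 1 :+ ν 2 :* z :* G :* y)
         := ν 1 :* (y′ :- (ν 0 :+ v′)) :+ ν 1 :* (v′ :- (w′ :+ (w′ :* w :+ w :* w′))))
       (λ _ → refl) G G′ y y′ v′ zₚ)
    (nat 1 · y′≈ ⊕₀ nat 1 · v′≈)

K12-S-root : ∀ G {y s} → y ≈ₚ nat 1 ⊕ zₚ ⊗ G ⊗ y ⊕ zₚ ⊗ zₚ ⊗ G ⊗ G ⊗ y ⊗ y →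
  IsSqrt s (nat 1 ⊖ nat 2 ⊗ zₚ ⊗ G ⊖ nat 3 ⊗ zₚ ⊗ zₚ ⊗ G ⊗ G) →
  nat 1 ⊖ zₚ ⊗ (G ⊕ nat 2 ⊗ zₚ ⊗ G ⊗ G ⊗ y) ≈ₚ s
K12-S-root G {y} value = IsSqrt-unique-1-z⊗ (G ⊕ nat 2 ⊗ zₚ ⊗ G ⊗ G ⊗ y) (by-combination _
  (solve 3 (λ G y z → let σ = ν 1 :- z :* (G :+ ν 2 :* z :* G :* G :* y) in
     σ :* σ :- (ν 1 :- ν 2 :* z :* G :- ν 3 :* z :* z :* G :* G)
       := (:- (ν 4 :* z :* z :* G :* G)) :* (y :- (ν 1 :+ z :* G :* y :+ z :* z :* G :* G :* y :* y)))
     (λ _ → refl) G y zₚ)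
  (negₚ (nat 4 ⊗ zₚ ⊗ zₚ ⊗ G ⊗ G) · value))

formula-K12-S : ∀ {G G′ y y′} → IsClass-at1 K12 clsS G G′ y y′ → Formula K12 clsS G G′ y′
formula-K12-S {G} {G′} {y} {y′} eqs s √Δ = by-combination _
  (solve 6 (λ G G′ y y′ s z → let σ = ν 1 :- z :* (G :+ ν 2 :* z :* G :* G :* y) in
     ν 2 :* z :* z :* G :* G :* G :* s :* y′
       :- ((ν 2 :- ν 3 :* z :* G :- ν 3 :* z :* z :* G :* G) :* G′ :+ (z :* G :- ν 2) :* G′ :* s)
       := (:- (ν 4 :* z :* z :* G :* G :* G′)) :* (y :- (ν 1 :+ z :* G :* y :+ z :* z :* G :* G :* y :* y))
          :+ ν 2 :* z :* z :* G :* G :* G :* (σ :* y′ :- z :* G′ :* y :* (ν 1 :+ ν 2 :* z :* G :* y))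
          :+ (:- (ν 2 :* z :* z :* G :* G :* G :* y′ :- (z :* G :- ν 2) :* G′)) :* (σ :- s))
     (λ _ → refl) G G′ y y′ s zₚ)
  (negₚ (nat 4 ⊗ zₚ ⊗ zₚ ⊗ G ⊗ G ⊗ G′) · value ⊕₀ nat 2 ⊗ zₚ ⊗ zₚ ⊗ G ⊗ G ⊗ G · slope
    ⊕₀ negₚ (nat 2 ⊗ zₚ ⊗ zₚ ⊗ G ⊗ G ⊗ G ⊗ y′ ⊖ (zₚ ⊗ G ⊖ nat 2) ⊗ G′) · σ≈s)
  where
  value = proj₁ (K12-S-equations {G} {G′} eqs)
  slope = proj₂ (K12-S-equations {G} {G′} eqs)
  σ≈s : nat 1 ⊖ zₚ ⊗ (G ⊕ nat 2 ⊗ zₚ ⊗ G ⊗ G ⊗ y) ≈ₚ s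
  σ≈s = K12-S-root G value √Δ

formula-K12-T : ∀ {G G′ t Ω} → IsClass-at1 K12 clsT G G′ t Ω → Formula K12 clsT G G′ Ω
formula-K12-T {G} {G′} {Ω = Ω} (y , y′ , eqs , _ , Ω≈) s √Δ = by-combination _
  (solve 7 (λ G G′ Ω y y′ s z → let σ = ν 1 :- z :* (G :+ ν 2 :* z :* G :* G :* y) in
     ν 2 :* z :* z :* G :* G :* s :* Ω :- ((ν 1 :- z :* G) :* G′ :- s :* G′)
       := ν 2 :* z :* z :* G :* G :* G :* (σ :* y′ :- z :* G′ :* y :* (ν 1 :+ ν 2 :* z :* G :* y))
          :+ ν 2 :* z :* z :* G :* G :* σ :* (Ω :- (G′ :* y :+ G :* y′))
          :+ (:- (ν 2 :* z :* z :* G :* G :* Ω :+ G′)) :* (σ :- s))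
     (λ _ → refl) G G′ Ω y y′ s zₚ)
  (nat 2 ⊗ zₚ ⊗ zₚ ⊗ G ⊗ G ⊗ G · slope ⊕₀ nat 2 ⊗ zₚ ⊗ zₚ ⊗ G ⊗ G ⊗ σ · Ω≈
    ⊕₀ negₚ (nat 2 ⊗ zₚ ⊗ zₚ ⊗ G ⊗ G ⊗ Ω ⊕ G′) · σ≈s)
  where
  σ = nat 1 ⊖ zₚ ⊗ (G ⊕ nat 2 ⊗ zₚ ⊗ G ⊗ G ⊗ y)
  slope = proj₂ (K12-S-equations {G} {G′} eqs)
  σ≈s : σ ≈ₚ s
  σ≈s = K12-S-root G (proj₁ (K12-S-equations {G} {G′} eqs)) √Δ

formula-K1-R : ∀ {G G′ r Ω} → IsClass-at1 K1 clsR G G′ r Ω → Formula K1 clsR G G′ Ω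
formula-K1-R {G′ = G′} {Ω = Ω} (_ , v′ , (_ , v′≈) , _ , Ω≈) = by-combination _
  (solve 4 (λ G′ Ω v′ z →
     (ν 1 :- z) :* Ω :- G′ := ν 1 :* (Ω :- (G′ :+ v′)) :+ ν 1 :* (v′ :- z :* Ω))
     (λ _ → refl) G′ Ω v′ zₚ)
  (nat 1 · Ω≈ ⊕₀ nat 1 · v′≈)

K1-S-equations : ∀ {G G′ y y′} → IsClass-at1 K1 clsS G G′ y y′ →
  y ≈ₚ nat 1 ⊕ zₚ ⊗ G ⊗ y × (nat 1 ⊖ zₚ ⊗ G) ⊗ y′ ≈ₚ zₚ ⊗ G′ ⊗ y
K1-S-equations {G} {G′} {y} {y′} (v , v′ , (v≈ , v′≈) , y≈ , y′≈) =
  by-combination _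
    (solve 4 (λ G y v z →
       y :- (ν 1 :+ z :* G :* y) := ν 1 :* (y :- (ν 1 :+ v)) :+ ν 1 :* (v :- z :* (G :* y)))
       (λ _ → refl) G y v zₚ)
    (nat 1 · y≈ ⊕₀ nat 1 · v≈) ,
  by-combination _
    (solve 6 (λ G G′ y y′ v′ z →
       (ν 1 :- z :* G) :* y′ :- z :* G′ :* y
         := ν 1 :* (y′ :- (ν 0 :+ v′)) :+ ν 1 :* (v′ :- z :* (G′ :* y :+ G :* y′)))
       (λ _ → refl) G G′ y y′ v′ zₚ)
    (nat 1 · y′≈ ⊕₀ nat 1 · v′≈)

formula-K1-S : ∀ {G G′ y y′} → IsClass-at1 K1 clsS G G′ y y′ → Formula K1 clsS G G′ y′
formula-K1-S {G} {G′} {y} {y′} eqs = by-combination _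
  (solve 5 (λ G G′ y y′ z →
     (ν 1 :- z :* G) :* (ν 1 :- z :* G) :* y′ :- z :* G′
       := z :* G′ :* (y :- (ν 1 :+ z :* G :* y)) :+ (ν 1 :- z :* G) :* ((ν 1 :- z :* G) :* y′ :- z :* G′ :* y))
     (λ _ → refl) G G′ y y′ zₚ)
  (zₚ ⊗ G′ · value ⊕₀ (nat 1 ⊖ zₚ ⊗ G) · slope)
  where
  value = proj₁ (K1-S-equations {G} {G′} eqs)
  slope = proj₂ (K1-S-equations {G} {G′} eqs)

formula-K1-T : ∀ {G G′ t Ω} → IsClass-at1 K1 clsT G G′ t Ω → Formula K1 clsT G G′ Ω
formula-K1-T {G} {G′} {Ω = Ω} (y , y′ , eqs , _ , Ω≈) = by-combination _
  (solve 6 (λ G G′ Ω y y′ z →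
     (ν 1 :- z :* G) :* (ν 1 :- z :* G) :* Ω :- G′
       := G′ :* (y :- (ν 1 :+ z :* G :* y)) :+ (ν 1 :- z :* G) :* G :* ((ν 1 :- z :* G) :* y′ :- z :* G′ :* y)
          :+ (ν 1 :- z :* G) :* (ν 1 :- z :* G) :* (Ω :- (G′ :* y :+ G :* y′)))
     (λ _ → refl) G G′ Ω y y′ zₚ)
  (G′ · value ⊕₀ (nat 1 ⊖ zₚ ⊗ G) ⊗ G · slope ⊕₀ (nat 1 ⊖ zₚ ⊗ G) ⊗ (nat 1 ⊖ zₚ ⊗ G) · Ω≈)
  where
  value = proj₁ (K1-S-equations {G} {G′} eqs)
  slope = proj₂ (K1-S-equations {G} {G′} eqs)

formula : ∀ K cls {G G′ y y′} → IsClass-at1 K cls G G′ y y′ → Formula K cls G G′ y′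
formula Kall clsR {G} {G′} {y} {y′} = formula-Kall-R {G} {G′} {y} {y′}
formula Kall clsS {G} {G′} {y} {y′} = formula-Kall-S {G} {G′} {y} {y′}
formula Kall clsT {G} {G′} {y} {y′} = formula-Kall-T {G} {G′} {y} {y′}
formula K2   clsR {G} {G′} {y} {y′} = formula-K2-R {G} {G′} {y} {y′}
formula K2   clsS {G} {G′} {y} {y′} = formula-K2-S {G} {G′} {y} {y′}
formula K2   clsT {G} {G′} {y} {y′} = formula-K2-T {G} {G′} {y} {y′}
formula K12  clsR {G} {G′} {y} {y′} = formula-K12-R {G} {G′} {y} {y′}
formula K12  clsS {G} {G′} {y} {y′} = formula-K12-S {G} {G′} {y} {y′}
formula K12  clsT {G} {G′} {y} {y′} = formula-K12-T {G} {G′} {y} {y′}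
formula K1   clsR {G} {G′} {y} {y′} = formula-K1-R {G} {G′} {y} {y′}
formula K1   clsS {G} {G′} {y} {y′} = formula-K1-S {G} {G′} {y} {y′}
formula K1   clsT {G} {G′} {y} {y′} = formula-K1-T {G} {G′} {y} {y′}

At1-Φ : ∀ star {Fb F} (finF : UFin Fb) → at1 Fb finF ≈ₚ F → At1 (Φ star Fb) (Gof star F) (du1 Fb finF)
At1-Φ false finF F≈ = record { finite = finF ; at1≈ = F≈ ; du1≈ = ≈ₚ-refl }
At1-Φ true  finF F≈ = record
  { finite = At1.finite F⊟1
  ; at1≈   = At1.at1≈ F⊟1
  ; du1≈   = ≈ₚ-trans (At1.du1≈ F⊟1) (⊖-identityʳ (du1 _ finF)) }
  where
  ⊖-identityʳ : ∀ a → a ⊖ 0P ≈ₚ a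
  ⊖-identityʳ a n = trans (cong (λ c → a n ℚ.- c) (cst-0 n)) (+-identityʳ (a n))
  F⊟1 = At1-⊟ (record { finite = finF ; at1≈ = F≈ ; du1≈ = ≈ₚ-refl }) At1-oneB

proposition4 : (fk : FlowerKind) (N : ℕ → Bool) → N 0 ≡ false → ∃ (λ n → N n ≡ true) →
    (K : KType) (cls : Cls) (star : Bool) →
    (Fb : BS) (finF : UFin Fb) → at1 Fb finF ≈ₚ flowerGF fk N →
    (f : BS) (finf : UFin f) → IsClassGF K cls (Φ star Fb) f →
    Formula K cls (Gof star (flowerGF fk N)) (du1 Fb finF) (du1 f finf)
proposition4 fk N _ _ K cls star Fb finF F≈ f finf isClass =
  formula K cls (at1-IsClassGF K cls finf (At1-Φ star finF F≈) isClass)
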